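{- Let $G=(V,E)$ be a finite oriented graph with incidence matrix $A\in\{0,\pm1\}^{V\times E}$. For $b\in\mathbb{Z}^V$ let $P^\circ_G(b)=\{p\in\mathbb{R}^E: Ap=b,\ 0<p_e<1 \text{ for all } e\in E\}$ and let $\mathcal{B}_G=\{b\in\mathbb{Z}^V: P^\circ_G(b)\neq\emptyset\}$ (a finite set). Then for every positive integer $k$, $$\overline{\varphi}_G(k)=\sum_{b\in\mathcal{B}_G}\bigl|\,(k\cdot P^\circ_G(b))\cap\mathbb{Z}^E\bigr|,$$ i.e. $\overline{\varphi}_G$ is a sum of the Ehrhart polynomials of the relatively open polytopes $P^\circ_G(b)$, $b\in\mathcal{B}_G$.
   Context: Oriented graphs may have loops and multiple edges. The incidence matrix $A$ has $A_{v,e}=1$ if the (non-loop) edge $e$ enters $v$, $A_{v,e}=-1$ if $e$ leaves $v$, and $0$ otherwise (columns of loops are zero). A $\mathbb{Z}_k$-flow is a map $f:E\to\mathbb{Z}_k$ with $Af=0$ over $\mathbb{Z}_k$; it is nowhere-zero if $f(e)\neq0$ for all $e$. $\overline{\varphi}_G(k)$ is the number of nowhere-zero $\mathbb{Z}_k$-flows of $G$.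
   Formalization: The points p of the relatively open polytopes $P^\circ_G(b)$ are taken in ℚ^E instead of $\mathbb{R}^E$. -}

module Defs where

open import Data.Nat as ℕ using (ℕ; zero; suc)
open import Data.Fin using (Fin; zero; suc; toℕ)
open import Data.Fin.Properties using () renaming (_≟_ to _≟ᶠ_)
open import Data.Integer as ℤ using (ℤ; +_)
open import Data.Integer.Divisibility as ℤD using ()
open import Data.Rational as ℚ using (ℚ; 0ℚ; 1ℚ)
open import Data.Vec using (Vec; lookup)
open import Data.List using (List; length)
open import Data.List.Membership.Propositional using (_∈_)
open import Data.List.Relation.Unary.Unique.Propositional using (Unique)
open import Data.Product using (Σ; ∃; _×_)
open import Relation.Nullary using (¬_; does)
open import Relation.Binary.PropositionalEquality using (_≡_)
open import Data.Bool using (if_then_else_)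
open import Function.Bundles using (_⇔_)

-- A finite oriented graph with vertex set Fin n and edge set Fin m
-- (loops and multiple edges allowed): edge e goes from tail e to head e.
record Graph (n m : ℕ) : Set where
  field
    tail : Fin m → Fin n
    head : Fin m → Fin n
open Graph public

Σℤ : ∀ {m} → (Fin m → ℤ) → ℤ
Σℤ {zero}  f = + 0
Σℤ {suc m} f = f zero ℤ.+ Σℤ (λ i → f (suc i))

Σℚ : ∀ {m} → (Fin m → ℚ) → ℚ
Σℚ {zero}  f = 0ℚ
Σℚ {suc m} f = f zero ℚ.+ Σℚ (λ i → f (suc i))

-- Incidence matrix: +1 if e enters v, -1 if e leaves v (loops give 0).
inc : ∀ {n m} → Graph n m → Fin n → Fin m → ℤ
inc G v e =
  (if does (head G e ≟ᶠ v) then + 1 else + 0)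
  ℤ.- (if does (tail G e ≟ᶠ v) then + 1 else + 0)

-- Z_k-flow, with Z_k represented by Fin k (values 0..k-1):
-- A f = 0 over Z_k, i.e. k divides every coordinate of A f computed in ℤ.
IsZkFlow : ∀ {n m} → Graph n m → (k : ℕ) → Vec (Fin k) m → Set
IsZkFlow G k f =
  ∀ v → (+ k) ℤD.∣ Σℤ (λ e → inc G v e ℤ.* (+ toℕ (lookup f e)))

NowhereZero : ∀ {m k} → Vec (Fin k) m → Set
NowhereZero f = ∀ e → ¬ (toℕ (lookup f e) ≡ 0)

IsNZFlow : ∀ {n m} → Graph n m → (k : ℕ) → Vec (Fin k) m → Set
IsNZFlow G k f = IsZkFlow G k f × NowhereZero f

IsCount : {X : Set} → (X → Set) → ℕ → Set
IsCount {X} P c =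
  Σ (List X) λ L → Unique L × length L ≡ c × (∀ x → (P x ⇔ (x ∈ L)))

-- Relatively open polytope P°_G(b) = {p : A p = b, 0 < p_e < 1}
-- (real coordinates replaced by rational ones).
InPo : ∀ {n m} → Graph n m → Vec ℤ n → Vec ℚ m → Set
InPo G b p =
  (∀ v → Σℚ (λ e → (inc G v e ℚ./ 1) ℚ.* lookup p e) ≡ (lookup b v ℚ./ 1))
  × (∀ e → (0ℚ ℚ.< lookup p e) × (lookup p e ℚ.< 1ℚ))

InB : ∀ {n m} → Graph n m → Vec ℤ n → Set
InB G b = ∃ λ p → InPo G b p

InDilate : ∀ {n m} → Graph n m → ℕ → Vec ℤ n → Vec ℤ m → Set
InDilate G k b x =
  ∃ λ p → InPo G b p × (∀ e → (lookup x e ℚ./ 1) ≡ ((+ k) ℚ./ 1) ℚ.* lookup p e)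

module Submission where

open import Defs
open import Data.Nat using (ℕ; _≤_)
open import Data.Integer using (ℤ)
open import Data.Vec using (Vec; lookup)
open import Data.List using (List; length)
open import Data.List.Membership.Propositional using (_∈_)
open import Data.List.Relation.Unary.Unique.Propositional using (Unique)
open import Data.Product using (Σ; ∃; _×_)
open import Relation.Binary.PropositionalEquality using (_≡_)
open import Function.Bundles using (_⇔_)
open import Data.Fin using (Fin)
import Data.List
import Data.Vec

open import Data.Nat as ℕ using (zero; suc; _<_; z≤n; s≤s)
import Data.Nat.Properties as ℕP
import Data.Nat.Divisibility as ℕD
import Data.Nat.GCD as ℕG
import Data.Nat.Coprimality as C
open import Data.Fin as F using (zero; suc; toℕ; fromℕ<) renaming (_≟_ to _≟ᶠ_)
import Data.Fin.Properties as FP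
open import Data.Integer as ℤ using (+_; -[1+_]; -1ℤ)
import Data.Integer.Properties as ℤP
import Data.Integer.GCD as ℤG
open import Data.Integer.Divisibility.Signed as ℤS using (divides)
open import Data.Integer.Tactic.RingSolver using (solve-∀)
open import Data.Rational as ℚ using (ℚ; mkℚ; 0ℚ; 1ℚ)
import Data.Rational.Properties as ℚP
import Data.Rational.Unnormalised as ℚᵘ
import Data.Rational.Unnormalised.Properties as ℚᵘP
open import Data.Vec as V using ([]; _∷_; tabulate)
import Data.Vec.Properties as VP
open import Data.List as L using (filter; map; concatMap; cartesianProductWith; deduplicate; allFin)
import Data.List.Properties as LP
open import Data.List.Membership.Propositional.Properties
open import Data.List.Relation.Unary.Any as Any using (Any; here; there)
open import Data.List.Relation.Unary.All as All using (All)
import Data.List.Relation.Unary.All.Properties as AllP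
import Data.List.Relation.Unary.Unique.Propositional.Properties as UP
import Data.List.Relation.Unary.Unique.DecPropositional.Properties as UDP
import Data.List.Relation.Unary.AllPairs as AP
import Data.List.Relation.Unary.AllPairs.Properties as APP
open import Data.List.Relation.Binary.Disjoint.Propositional using (Disjoint)
open import Data.Product using (_,_; proj₁; proj₂)
open import Data.Sum using (_⊎_; inj₁; inj₂; [_,_]′)
open import Data.Bool using (Bool; true; false; if_then_else_)
open import Data.Empty using (⊥-elim)
open import Relation.Nullary using (¬_; Dec; yes; no; does)
open import Relation.Nullary.Decidable using (_×-dec_; _⊎-dec_; ¬?; decidable-stable)
open import Relation.Binary.Definitions using (tri<; tri≈; tri>)
open import Relation.Binary.PropositionalEquality using (refl; sym; trans; cong; cong₂; subst; subst₂; module ≡-Reasoning)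
open import Function.Bundles using (mk⇔; Equivalence)

-- Reading a nowhere-zero Z_k-flow f as an integer vector with entries in (0, k),
-- A f = k b for a unique integer vector b, and f / k ∈ P°_G(b); conversely every
-- lattice point of k · P°_G(b) is such a flow.  So the flows split into disjoint
-- blocks indexed by the b with P°_G(b) ≠ ∅, and the theorem is a matter of counting
-- once B_G = {b : P°_G(b) ≠ ∅} is exhibited as an explicit finite list.
--
-- The integrality of the polytope
-- {0 ≤ p ≤ 1, A p = b} (incidence matrices are totally unimodular) is proved by
-- cycle cancelling: if x ∈ [0, d]^E solves A x = d b, its fractional edges contain
-- a closed trail, and pushing flow around it makes one more edge integral; hence x
-- rounds to a 0/1 solution of A z = b.  Consequently b ∈ B_G iff the finite set S(b)
-- of 0/1 solutions is nonempty and every edge takes both values 0 and 1 on S(b).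

Σℤ-cong : ∀ {m} {f g : Fin m → ℤ} → (∀ e → f e ≡ g e) → Σℤ f ≡ Σℤ g
Σℤ-cong {zero}  f≗g = refl
Σℤ-cong {suc m} f≗g = cong₂ ℤ._+_ (f≗g zero) (Σℤ-cong (λ e → f≗g (suc e)))

Σℤ-zero : ∀ m → Σℤ {m} (λ _ → + 0) ≡ + 0
Σℤ-zero zero    = refl
Σℤ-zero (suc m) = trans (ℤP.+-identityˡ _) (Σℤ-zero m)

Σℤ-+ : ∀ {m} (f g : Fin m → ℤ) → Σℤ (λ e → f e ℤ.+ g e) ≡ Σℤ f ℤ.+ Σℤ g
Σℤ-+ {zero}  f g = refl
Σℤ-+ {suc m} f g =
  trans (cong (λ s → (f zero ℤ.+ g zero) ℤ.+ s) (Σℤ-+ (λ e → f (suc e)) (λ e → g (suc e))))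
        (interchange (f zero) (g zero) _ _)
  where
  interchange : ∀ a b c d → (a ℤ.+ b) ℤ.+ (c ℤ.+ d) ≡ (a ℤ.+ c) ℤ.+ (b ℤ.+ d)
  interchange = solve-∀

Σℤ-scale : ∀ {m} c (f : Fin m → ℤ) → Σℤ (λ e → c ℤ.* f e) ≡ c ℤ.* Σℤ f
Σℤ-scale {zero}  c f = sym (ℤP.*-zeroʳ c)
Σℤ-scale {suc m} c f =
  trans (cong (λ s → c ℤ.* f zero ℤ.+ s) (Σℤ-scale c (λ e → f (suc e))))
        (sym (ℤP.*-distribˡ-+ c (f zero) _))

Σℤ-indicator : ∀ {m} (c : Fin m) (h : Fin m → ℤ) →
               Σℤ (λ e → if does (e ≟ᶠ c) then h e else + 0) ≡ h c
Σℤ-indicator {suc m} zero    h = trans (cong (λ s → h zero ℤ.+ s) (Σℤ-zero m)) (ℤP.+-identityʳ _)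
Σℤ-indicator {suc m} (suc c) h = trans (ℤP.+-identityˡ _) (Σℤ-indicator c (λ e → h (suc e)))

∣-Σℤ : ∀ {m} {d} (f : Fin m → ℤ) → (∀ e → d ℤS.∣ f e) → d ℤS.∣ Σℤ f
∣-Σℤ {zero}  f d∣f = divides (+ 0) refl
∣-Σℤ {suc m} f d∣f = ℤS.∣m∣n⇒∣m+n (d∣f zero) (∣-Σℤ (λ e → f (suc e)) (λ e → d∣f (suc e)))

∣-Σℤ-except : ∀ {m} {d} (f : Fin m → ℤ) (ℓ : Fin m) →
              d ℤS.∣ Σℤ f → (∀ e → ¬ e ≡ ℓ → d ℤS.∣ f e) → d ℤS.∣ f ℓ
∣-Σℤ-except f zero d∣Σ others =
  ℤS.∣m+n∣n⇒∣m d∣Σ (∣-Σℤ (λ e → f (suc e)) (λ e → others (suc e) (λ ())))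
∣-Σℤ-except f (suc ℓ) d∣Σ others =
  ∣-Σℤ-except (λ e → f (suc e)) ℓ (ℤS.∣m+n∣m⇒∣n d∣Σ (others zero (λ ())))
              (λ e e≢ℓ → others (suc e) (λ eq → e≢ℓ (FP.suc-injective eq)))

Σ< : ℕ → (ℕ → ℤ) → ℤ
Σ< zero    f = + 0
Σ< (suc g) f = Σ< g f ℤ.+ f g

Σ<-cong : ∀ g {f h : ℕ → ℤ} → (∀ α → α < g → f α ≡ h α) → Σ< g f ≡ Σ< g h
Σ<-cong zero    f≗h = refl
Σ<-cong (suc g) f≗h = cong₂ ℤ._+_ (Σ<-cong g (λ α α<g → f≗h α (ℕP.m<n⇒m<1+n α<g))) (f≗h g ℕP.≤-refl)

Σ<-zero : ∀ g {f : ℕ → ℤ} → (∀ α → α < g → f α ≡ + 0) → Σ< g f ≡ + 0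
Σ<-zero zero    f≗0 = refl
Σ<-zero (suc g) f≗0 =
  cong₂ ℤ._+_ (Σ<-zero g (λ α α<g → f≗0 α (ℕP.m<n⇒m<1+n α<g))) (f≗0 g ℕP.≤-refl)

Σ<-single : ∀ g {f : ℕ → ℤ} α₀ → α₀ < g → (∀ α → α < g → ¬ α ≡ α₀ → f α ≡ + 0) → Σ< g f ≡ f α₀
Σ<-single (suc g) {f} α₀ α₀<1+g others with α₀ ℕ.≟ g
... | yes refl =
  trans (cong (ℤ._+ f g) (Σ<-zero g (λ α α<g → others α (ℕP.m<n⇒m<1+n α<g) (ℕP.<⇒≢ α<g))))
        (ℤP.+-identityˡ _)
... | no α₀≢g =
  trans (cong₂ ℤ._+_ (Σ<-single g α₀ (ℕP.≤∧≢⇒< (ℕP.≤-pred α₀<1+g) α₀≢g)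
                                (λ α α<g → others α (ℕP.m<n⇒m<1+n α<g)))
                     (others g ℕP.≤-refl (λ g≡α₀ → α₀≢g (sym g≡α₀))))
        (ℤP.+-identityʳ _)

Σ<-telescope : ∀ g (F : ℕ → ℤ) → Σ< g (λ α → F (suc α) ℤ.- F α) ≡ F g ℤ.- F 0
Σ<-telescope zero    F = sym (ℤP.+-inverseʳ (F 0))
Σ<-telescope (suc g) F =
  trans (cong (ℤ._+ (F (suc g) ℤ.- F g)) (Σ<-telescope g F)) (collapse (F g) (F 0) (F (suc g)))
  where
  collapse : ∀ a b c → (a ℤ.- b) ℤ.+ (c ℤ.- a) ≡ c ℤ.- b
  collapse = solve-∀

Σ<-scale : ∀ g c (f : ℕ → ℤ) → Σ< g (λ α → c ℤ.* f α) ≡ c ℤ.* Σ< g f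
Σ<-scale zero    c f = sym (ℤP.*-zeroʳ c)
Σ<-scale (suc g) c f =
  trans (cong (ℤ._+ c ℤ.* f g) (Σ<-scale g c f)) (sym (ℤP.*-distribˡ-+ c (Σ< g f) (f g)))

Σℤ-Σ<-swap : ∀ {m} g (F : Fin m → ℕ → ℤ) → Σℤ (λ e → Σ< g (F e)) ≡ Σ< g (λ α → Σℤ (λ e → F e α))
Σℤ-Σ<-swap {m} zero    F = Σℤ-zero m
Σℤ-Σ<-swap     (suc g) F =
  trans (Σℤ-+ (λ e → Σ< g (F e)) (λ e → F e g)) (cong (ℤ._+ Σℤ (λ e → F e g)) (Σℤ-Σ<-swap g F))

netIn : ∀ {n m} → Graph n m → (Fin m → ℤ) → Fin n → ℤ
netIn G x v = Σℤ (λ e → inc G v e ℤ.* x e)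

module _ {n m} (G : Graph n m) where

  netIn-cong : ∀ {x y : Fin m → ℤ} → (∀ e → x e ≡ y e) → ∀ v → netIn G x v ≡ netIn G y v
  netIn-cong x≗y v = Σℤ-cong (λ e → cong (inc G v e ℤ.*_) (x≗y e))

  netIn-+ : ∀ (x y : Fin m → ℤ) v → netIn G (λ e → x e ℤ.+ y e) v ≡ netIn G x v ℤ.+ netIn G y v
  netIn-+ x y v =
    trans (Σℤ-cong (λ e → ℤP.*-distribˡ-+ (inc G v e) (x e) (y e)))
          (Σℤ-+ (λ e → inc G v e ℤ.* x e) (λ e → inc G v e ℤ.* y e))

  netIn-scale : ∀ c (x : Fin m → ℤ) v → netIn G (λ e → c ℤ.* x e) v ≡ c ℤ.* netIn G x v
  netIn-scale c x v =
    trans (Σℤ-cong (λ e → swap (inc G v e) c (x e))) (Σℤ-scale c (λ e → inc G v e ℤ.* x e))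
    where
    swap : ∀ a c x → a ℤ.* (c ℤ.* x) ≡ c ℤ.* (a ℤ.* x)
    swap = solve-∀

  netIn-- : ∀ (x y : Fin m → ℤ) v → netIn G (λ e → x e ℤ.- y e) v ≡ netIn G x v ℤ.- netIn G y v
  netIn-- x y v = begin
    netIn G (λ e → x e ℤ.- y e) v              ≡⟨ netIn-cong (λ e → cong (λ s → x e ℤ.+ s) (sym (ℤP.-1*i≡-i (y e)))) v ⟩
    netIn G (λ e → x e ℤ.+ -1ℤ ℤ.* y e) v       ≡⟨ netIn-+ x (λ e → -1ℤ ℤ.* y e) v ⟩
    netIn G x v ℤ.+ netIn G (λ e → -1ℤ ℤ.* y e) v ≡⟨ cong (λ s → netIn G x v ℤ.+ s) (netIn-scale -1ℤ y v) ⟩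
    netIn G x v ℤ.+ -1ℤ ℤ.* netIn G y v          ≡⟨ cong (λ s → netIn G x v ℤ.+ s) (ℤP.-1*i≡-i (netIn G y v)) ⟩
    netIn G x v ℤ.- netIn G y v ∎
    where open ≡-Reasoning

Solves : ∀ {n m} → Graph n m → ℕ → (Fin n → ℤ) → (Fin m → ℤ) → Set
Solves G d b x = ∀ v → netIn G x v ≡ + d ℤ.* b v

InOpenBox : ∀ {m} → ℕ → (Fin m → ℤ) → Set
InOpenBox d x = ∀ e → (+ 0 ℤ.< x e) × (x e ℤ.< + d)

InBox : ∀ {m} → ℕ → (Fin m → ℤ) → Set
InBox d x = ∀ e → (+ 0 ℤ.≤ x e) × (x e ℤ.≤ + d)

openBox⇒box : ∀ {m d} {x : Fin m → ℤ} → InOpenBox d x → InBox d x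
openBox⇒box inside e = ℤP.<⇒≤ (proj₁ (inside e)) , ℤP.<⇒≤ (proj₂ (inside e))

ι : ℤ → ℚ
ι i = i ℚ./ 1

ι-mkℚ : ∀ i → ι i ≡ mkℚ i 0 (C.sym (C.1-coprimeTo _))
ι-mkℚ i = ℚP.≃⇒≡ (ℚ.*≡* (begin
    ℚ.↥ (ι i) ℤ.* + 1  ≡⟨ ℤP.*-identityʳ _ ⟩
    ℚ.↥ (ι i)          ≡⟨ ↥ι ⟩
    i                  ≡⟨ sym (ℤP.*-identityʳ i) ⟩
    i ℤ.* + 1          ≡⟨ cong (i ℤ.*_) (sym ↧ι) ⟩
    i ℤ.* ℚ.↧ (ι i)    ∎))
  where
  open ≡-Reasoning
  gcd-1 : ℤG.gcd i (+ 1) ≡ + 1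
  gcd-1 = cong +_ (ℕG.gcd-zeroʳ ℤ.∣ i ∣)
  ↥ι : ℚ.↥ (ι i) ≡ i
  ↥ι = trans (sym (ℤP.*-identityʳ _)) (trans (cong (ℚ.↥ (ι i) ℤ.*_) (sym gcd-1)) (ℚP.↥-/ i 1))
  ↧ι : ℚ.↧ (ι i) ≡ + 1
  ↧ι = trans (sym (ℤP.*-identityʳ _)) (trans (cong (ℚ.↧ (ι i) ℤ.*_) (sym gcd-1)) (ℚP.↧-/ i 1))

ι-+ : ∀ a b → ι (a ℤ.+ b) ≡ ι a ℚ.+ ι b
ι-+ a b rewrite ι-mkℚ a | ι-mkℚ b =
  cong ι (cong₂ ℤ._+_ (sym (ℤP.*-identityʳ a)) (sym (ℤP.*-identityʳ b)))

ι-* : ∀ a b → ι (a ℤ.* b) ≡ ι a ℚ.* ι b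
ι-* a b rewrite ι-mkℚ a | ι-mkℚ b = refl

ι-injective : ∀ {a b} → ι a ≡ ι b → a ≡ b
ι-injective {a} {b} eq rewrite ι-mkℚ a | ι-mkℚ b = cong ℚ.↥_ eq

ι-mono-< : ∀ {a b} → a ℤ.< b → ι a ℚ.< ι b
ι-mono-< {a} {b} a<b rewrite ι-mkℚ a | ι-mkℚ b =
  ℚ.*<* (subst₂ ℤ._<_ (sym (ℤP.*-identityʳ a)) (sym (ℤP.*-identityʳ b)) a<b)

ι-cancel-< : ∀ {a b} → ι a ℚ.< ι b → a ℤ.< b
ι-cancel-< {a} {b} ιa<ιb rewrite ι-mkℚ a | ι-mkℚ b with ιa<ιb
... | ℚ.*<* a*1<b*1 = subst₂ ℤ._<_ (ℤP.*-identityʳ a) (ℤP.*-identityʳ b) a*1<b*1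

Σℚ-cong : ∀ {m} {f g : Fin m → ℚ} → (∀ e → f e ≡ g e) → Σℚ f ≡ Σℚ g
Σℚ-cong {zero}  f≗g = refl
Σℚ-cong {suc m} f≗g = cong₂ ℚ._+_ (f≗g zero) (Σℚ-cong (λ e → f≗g (suc e)))

Σℚ-ι : ∀ {m} (f : Fin m → ℤ) → Σℚ (λ e → ι (f e)) ≡ ι (Σℤ f)
Σℚ-ι {zero}  f = refl
Σℚ-ι {suc m} f =
  trans (cong (ι (f zero) ℚ.+_) (Σℚ-ι (λ e → f (suc e)))) (sym (ι-+ (f zero) (Σℤ (λ e → f (suc e)))))

Σℚ-scale : ∀ {m} c (f : Fin m → ℚ) → Σℚ (λ e → c ℚ.* f e) ≡ c ℚ.* Σℚ f
Σℚ-scale {zero}  c f = sym (ℚP.*-zeroʳ c)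
Σℚ-scale {suc m} c f =
  trans (cong (c ℚ.* f zero ℚ.+_) (Σℚ-scale c (λ e → f (suc e)))) (sym (ℚP.*-distribˡ-+ c _ _))

private
  swap-* : ∀ a c p → a ℚ.* (c ℚ.* p) ≡ c ℚ.* (a ℚ.* p)
  swap-* a c p =
    trans (sym (ℚP.*-assoc a c p)) (trans (cong (ℚ._* p) (ℚP.*-comm a c)) (ℚP.*-assoc c a p))

ι-positive : ∀ k → 1 ≤ k → ℚ.Positive (ι (+ k))
ι-positive k 1≤k = ℚ.positive (ι-mono-< (ℤ.+<+ 1≤k))

module Dilation {n m} (G : Graph n m) (k : ℕ) (1≤k : 1 ≤ k) (b : Vec ℤ n) where

  private
    K : ℚ
    K = ι (+ k)
    instance
      K-positive : ℚ.Positive K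
      K-positive = ι-positive k 1≤k
      K-nonZero : ℚ.NonZero K
      K-nonZero = ℚP.pos⇒nonZero K
      K-nonNeg : ℚ.NonNegative K
      K-nonNeg = ℚP.pos⇒nonNeg K

  InDilate⇒lattice : ∀ x → InDilate G k b x → Solves G k (lookup b) (lookup x) × InOpenBox k (lookup x)
  InDilate⇒lattice x (p , (Ap≡b , 0<p<1) , x≡Kp) = solves , inside
    where
    solves : Solves G k (lookup b) (lookup x)
    solves v = ι-injective (begin
      ι (netIn G (lookup x) v)                    ≡⟨ sym (Σℚ-ι (λ e → inc G v e ℤ.* lookup x e)) ⟩
      Σℚ (λ e → ι (inc G v e ℤ.* lookup x e))    ≡⟨ Σℚ-cong (λ e → trans (ι-* (inc G v e) (lookup x e))
                                                       (trans (cong (ι (inc G v e) ℚ.*_) (x≡Kp e))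
                                                              (swap-* (ι (inc G v e)) K (lookup p e)))) ⟩
      Σℚ (λ e → K ℚ.* (ι (inc G v e) ℚ.* lookup p e)) ≡⟨ Σℚ-scale K (λ e → ι (inc G v e) ℚ.* lookup p e) ⟩
      K ℚ.* Σℚ (λ e → ι (inc G v e) ℚ.* lookup p e)  ≡⟨ cong (K ℚ.*_) (Ap≡b v) ⟩
      K ℚ.* ι (lookup b v)                         ≡⟨ sym (ι-* (+ k) (lookup b v)) ⟩
      ι (+ k ℤ.* lookup b v)                       ∎)
      where open ≡-Reasoning
    inside : InOpenBox k (lookup x)
    inside e =
      ι-cancel-< (subst₂ ℚ._<_ (ℚP.*-zeroʳ K) (sym (x≡Kp e)) (ℚP.*-monoʳ-<-pos K (proj₁ (0<p<1 e)))) ,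
      ι-cancel-< (subst₂ ℚ._<_ (sym (x≡Kp e)) (ℚP.*-identityʳ K) (ℚP.*-monoʳ-<-pos K (proj₂ (0<p<1 e))))

  lattice⇒InDilate : ∀ x → Solves G k (lookup b) (lookup x) → InOpenBox k (lookup x) → InDilate G k b x
  lattice⇒InDilate x solves inside = p , (Ap≡b , 0<p<1) , λ e → sym (Kp≡x e)
    where
    K⁻¹ : ℚ
    K⁻¹ = ℚ.1/ K
    p : Vec ℚ m
    p = tabulate (λ e → K⁻¹ ℚ.* ι (lookup x e))
    K⁻¹-cancel : ∀ q → K⁻¹ ℚ.* (K ℚ.* q) ≡ q
    K⁻¹-cancel q = trans (sym (ℚP.*-assoc K⁻¹ K q))
                         (trans (cong (ℚ._* q) (ℚP.*-inverseˡ K)) (ℚP.*-identityˡ q))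
    Kp≡x : ∀ e → K ℚ.* lookup p e ≡ ι (lookup x e)
    Kp≡x e = begin
      K ℚ.* lookup p e                   ≡⟨ cong (K ℚ.*_) (VP.lookup∘tabulate _ e) ⟩
      K ℚ.* (K⁻¹ ℚ.* ι (lookup x e))     ≡⟨ sym (ℚP.*-assoc K K⁻¹ _) ⟩
      (K ℚ.* K⁻¹) ℚ.* ι (lookup x e)     ≡⟨ cong (ℚ._* ι (lookup x e)) (ℚP.*-inverseʳ K) ⟩
      1ℚ ℚ.* ι (lookup x e)              ≡⟨ ℚP.*-identityˡ _ ⟩
      ι (lookup x e)                     ∎
      where open ≡-Reasoning
    Ap≡b : ∀ v → Σℚ (λ e → ι (inc G v e) ℚ.* lookup p e) ≡ ι (lookup b v)
    Ap≡b v = begin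
      Σℚ (λ e → ι (inc G v e) ℚ.* lookup p e)    ≡⟨ Σℚ-cong (λ e → trans (cong (ι (inc G v e) ℚ.*_) (VP.lookup∘tabulate _ e))
                                                      (trans (swap-* (ι (inc G v e)) K⁻¹ (ι (lookup x e)))
                                                             (cong (K⁻¹ ℚ.*_) (sym (ι-* (inc G v e) (lookup x e)))))) ⟩
      Σℚ (λ e → K⁻¹ ℚ.* ι (inc G v e ℤ.* lookup x e)) ≡⟨ Σℚ-scale K⁻¹ (λ e → ι (inc G v e ℤ.* lookup x e)) ⟩
      K⁻¹ ℚ.* Σℚ (λ e → ι (inc G v e ℤ.* lookup x e)) ≡⟨ cong (K⁻¹ ℚ.*_) (Σℚ-ι (λ e → inc G v e ℤ.* lookup x e)) ⟩
      K⁻¹ ℚ.* ι (netIn G (lookup x) v)             ≡⟨ cong (λ q → K⁻¹ ℚ.* ι q) (solves v) ⟩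
      K⁻¹ ℚ.* ι (+ k ℤ.* lookup b v)               ≡⟨ cong (K⁻¹ ℚ.*_) (ι-* (+ k) (lookup b v)) ⟩
      K⁻¹ ℚ.* (K ℚ.* ι (lookup b v))               ≡⟨ K⁻¹-cancel (ι (lookup b v)) ⟩
      ι (lookup b v)                               ∎
      where open ≡-Reasoning
    0<p<1 : ∀ e → (0ℚ ℚ.< lookup p e) × (lookup p e ℚ.< 1ℚ)
    0<p<1 e =
      ℚP.*-cancelˡ-<-nonNeg K (subst₂ ℚ._<_ (sym (ℚP.*-zeroʳ K)) (sym (Kp≡x e)) (ι-mono-< (proj₁ (inside e)))) ,
      ℚP.*-cancelˡ-<-nonNeg K (subst₂ ℚ._<_ (sym (Kp≡x e)) (sym (ℚP.*-identityʳ K)) (ι-mono-< (proj₂ (inside e))))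

denominator-clears : ∀ q → ι (+ ℚ.↧ₙ q) ℚ.* q ≡ ι (ℚ.↥ q)
denominator-clears q@(mkℚ a k _) =
  ℚP.toℚᵘ-injective (ℚᵘP.≃-trans (ℚP.toℚᵘ-homo-* (ι (+ suc k)) q) cleared)
  where
  cleared : ℚ.toℚᵘ (ι (+ suc k)) ℚᵘ.* ℚ.toℚᵘ q ℚᵘ.≃ ℚ.toℚᵘ (ι a)
  cleared rewrite ι-mkℚ (+ suc k) | ι-mkℚ a =
    ℚᵘ.*≡* (trans (cross (+ suc k) a) (cong (λ j → a ℤ.* + suc j) (sym (ℕP.+-identityʳ k))))
    where
    cross : ∀ D a → (D ℤ.* a) ℤ.* + 1 ≡ a ℤ.* D
    cross = solve-∀

commonDenominator : ∀ {m} (p : Vec ℚ m) →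
  Σ ℕ λ d → (1 ≤ d) × Σ (Vec ℤ m) λ x → ∀ e → ι (lookup x e) ≡ ι (+ d) ℚ.* lookup p e
commonDenominator []      = 1 , ℕP.≤-refl , [] , λ ()
commonDenominator (q ∷ p) with commonDenominator p
... | d , 1≤d , x , x≡dp = D ℕ.* d , ℕP.*-mono-≤ {1} {D} (s≤s z≤n) 1≤d , x′ , x′≡Ddp
  where
  D : ℕ
  D = ℚ.↧ₙ q
  ι-Dd : ι (+ (D ℕ.* d)) ≡ ι (+ D) ℚ.* ι (+ d)
  ι-Dd = trans (cong ι (ℤP.pos-* D d)) (ι-* (+ D) (+ d))
  x′ : Vec ℤ _
  x′ = (ℚ.↥ q ℤ.* + d) ∷ V.map (+ D ℤ.*_) x
  x′≡Ddp : ∀ e → ι (lookup x′ e) ≡ ι (+ (D ℕ.* d)) ℚ.* lookup (q ∷ p) e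
  x′≡Ddp zero = begin
    ι (ℚ.↥ q ℤ.* + d)              ≡⟨ ι-* (ℚ.↥ q) (+ d) ⟩
    ι (ℚ.↥ q) ℚ.* ι (+ d)          ≡⟨ cong (ℚ._* ι (+ d)) (sym (denominator-clears q)) ⟩
    (ι (+ D) ℚ.* q) ℚ.* ι (+ d)    ≡⟨ ℚP.*-assoc (ι (+ D)) q (ι (+ d)) ⟩
    ι (+ D) ℚ.* (q ℚ.* ι (+ d))    ≡⟨ cong (ι (+ D) ℚ.*_) (ℚP.*-comm q (ι (+ d))) ⟩
    ι (+ D) ℚ.* (ι (+ d) ℚ.* q)    ≡⟨ sym (ℚP.*-assoc (ι (+ D)) (ι (+ d)) q) ⟩
    (ι (+ D) ℚ.* ι (+ d)) ℚ.* q    ≡⟨ cong (ℚ._* q) (sym ι-Dd) ⟩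
    ι (+ (D ℕ.* d)) ℚ.* q          ∎
    where open ≡-Reasoning
  x′≡Ddp (suc e) = begin
    ι (lookup (V.map (+ D ℤ.*_) x) e)         ≡⟨ cong ι (VP.lookup-map e (+ D ℤ.*_) x) ⟩
    ι (+ D ℤ.* lookup x e)                    ≡⟨ ι-* (+ D) (lookup x e) ⟩
    ι (+ D) ℚ.* ι (lookup x e)                ≡⟨ cong (ι (+ D) ℚ.*_) (x≡dp e) ⟩
    ι (+ D) ℚ.* (ι (+ d) ℚ.* lookup p e)      ≡⟨ sym (ℚP.*-assoc (ι (+ D)) (ι (+ d)) (lookup p e)) ⟩
    (ι (+ D) ℚ.* ι (+ d)) ℚ.* lookup p e      ≡⟨ cong (ℚ._* lookup p e) (sym ι-Dd) ⟩
    ι (+ (D ℕ.* d)) ℚ.* lookup p e            ∎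
    where open ≡-Reasoning

InB⇒lattice : ∀ {n m} (G : Graph n m) b → InB G b →
  Σ ℕ λ d → (1 ≤ d) × Σ (Fin m → ℤ) λ x → Solves G d (lookup b) x × InOpenBox d x
InB⇒lattice {m = m} G b (p , p∈P) = scaled (commonDenominator p)
  where
  scaled : (Σ ℕ λ d → (1 ≤ d) × Σ (Vec ℤ m) λ x → ∀ e → ι (lookup x e) ≡ ι (+ d) ℚ.* lookup p e) →
           Σ ℕ λ d → (1 ≤ d) × Σ (Fin m → ℤ) λ x → Solves G d (lookup b) x × InOpenBox d x
  scaled (d , 1≤d , x , x≡dp) = d , 1≤d , lookup x , Dilation.InDilate⇒lattice G d 1≤d b x (p , p∈P , x≡dp)

lattice⇒InB : ∀ {n m} (G : Graph n m) b d → 1 ≤ d → (x : Fin m → ℤ) →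
  Solves G d (lookup b) x → InOpenBox d x → InB G b
lattice⇒InB G b d 1≤d x solves inside = proj₁ dilate , proj₁ (proj₂ dilate)
  where
  dilate : InDilate G d b (tabulate x)
  dilate = Dilation.lattice⇒InDilate G d 1≤d b (tabulate x)
    (λ v → trans (netIn-cong G (VP.lookup∘tabulate x) v) (solves v))
    (λ e → subst (λ y → (+ 0 ℤ.< y) × (y ℤ.< + d)) (sym (VP.lookup∘tabulate x e)) (inside e))

if-true : ∀ {A P : Set} (P? : Dec P) {a c : A} → P → (if does P? then a else c) ≡ a
if-true (yes _) _ = refl
if-true (no ¬p) p = ⊥-elim (¬p p)

if-false : ∀ {A P : Set} (P? : Dec P) {a c : A} → ¬ P → (if does P? then a else c) ≡ c
if-false (yes p) ¬p = ⊥-elim (¬p p)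
if-false (no _)  _  = refl

δ : ∀ {n} → Fin n → Fin n → ℤ
δ u v = if does (u ≟ᶠ v) then + 1 else + 0

Joins : ∀ {n m} → Graph n m → Fin m → Fin n → Fin n → Set
Joins G e u w = ((tail G e ≡ u) × (head G e ≡ w)) ⊎ ((head G e ≡ u) × (tail G e ≡ w))

module _ {n m} (G : Graph n m) where

  Incident : Fin n → Fin m → Set
  Incident v e = (tail G e ≡ v) ⊎ (head G e ≡ v)

  incident? : ∀ v e → Dec (Incident v e)
  incident? v e = (tail G e ≟ᶠ v) ⊎-dec (head G e ≟ᶠ v)

  inc-nonincident : ∀ v e → ¬ Incident v e → inc G v e ≡ + 0
  inc-nonincident v e ¬inc with head G e ≟ᶠ v | tail G e ≟ᶠ v
  ... | yes h≡v | _       = ⊥-elim (¬inc (inj₂ h≡v))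
  ... | no _    | yes t≡v = ⊥-elim (¬inc (inj₁ t≡v))
  ... | no _    | no _    = refl

  inc-unit : ∀ v e → Incident v e → ¬ tail G e ≡ head G e → inc G v e ℤ.* inc G v e ≡ + 1
  inc-unit v e incident non-loop with head G e ≟ᶠ v | tail G e ≟ᶠ v
  ... | yes h≡v | yes t≡v = ⊥-elim (non-loop (trans t≡v (sym h≡v)))
  ... | yes _   | no _    = refl
  ... | no _    | yes _   = refl
  ... | no h≢v  | no t≢v  = ⊥-elim ([ t≢v , h≢v ]′ incident)

  other : Fin m → Fin n → Fin n
  other e v = if does (tail G e ≟ᶠ v) then head G e else tail G e

  joins-other : ∀ {v e} → Incident v e → Joins G e v (other e v)
  joins-other {v} {e} incident with tail G e ≟ᶠ v
  ... | yes t≡v = inj₁ (t≡v , refl)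
  ... | no  t≢v = inj₂ ([ (λ t≡v → ⊥-elim (t≢v t≡v)) , (λ h≡v → h≡v) ]′ incident , refl)

  joins-incident : ∀ {e u w} → Joins G e u w → Incident w e
  joins-incident (inj₁ (_ , h≡w)) = inj₂ h≡w
  joins-incident (inj₂ (_ , t≡w)) = inj₁ t≡w

  joins-loop : ∀ {e u w} → Joins G e u w → tail G e ≡ head G e → w ≡ u
  joins-loop (inj₁ (t≡u , h≡w)) t≡h = trans (sym h≡w) (trans (sym t≡h) t≡u)
  joins-loop (inj₂ (h≡u , t≡w)) t≡h = trans (sym t≡w) (trans t≡h h≡u)

  joins-shared : ∀ {e u u′ c c′} → Joins G e u u′ → Joins G e c c′ → (u ≡ c) ⊎ (u′ ≡ c)
  joins-shared (inj₁ (t≡u , _))   (inj₁ (t≡c , _))   = inj₁ (trans (sym t≡u) t≡c)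
  joins-shared (inj₁ (_ , h≡u′))  (inj₂ (h≡c , _))   = inj₂ (trans (sym h≡u′) h≡c)
  joins-shared (inj₂ (_ , t≡u′))  (inj₁ (t≡c , _))   = inj₂ (trans (sym t≡u′) t≡c)
  joins-shared (inj₂ (h≡u , _))   (inj₂ (h≡c , _))   = inj₁ (trans (sym h≡u) h≡c)

direction : ∀ {n m} → Graph n m → Fin m → Fin n → ℤ
direction G e u = if does (tail G e ≟ᶠ u) then + 1 else -1ℤ

direction-inc : ∀ {n m} (G : Graph n m) {e u w} v → Joins G e u w →
                direction G e u ℤ.* inc G v e ≡ δ w v ℤ.- δ u v
direction-inc G {e} {u} {w} v joins with tail G e ≟ᶠ u | joins
... | yes t≡u | inj₁ (_ , h≡w) =
  trans (ℤP.*-identityˡ _) (cong₂ (λ a c → δ a v ℤ.- δ c v) h≡w t≡u)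
... | yes t≡u | inj₂ (h≡u , t≡w) =
  trans (ℤP.*-identityˡ _) (cong₂ (λ a c → δ a v ℤ.- δ c v) (trans h≡u (trans (sym t≡u) t≡w)) t≡u)
... | no t≢u | inj₁ (t≡u , _) = ⊥-elim (t≢u t≡u)
... | no t≢u | inj₂ (h≡u , t≡w) =
  trans (ℤP.-1*i≡-i _) (trans (cong₂ (λ a c → ℤ.- (δ a v ℤ.- δ c v)) h≡u t≡w) (negate-difference (δ u v) (δ w v)))
  where
  negate-difference : ∀ a c → ℤ.- (a ℤ.- c) ≡ c ℤ.- a
  negate-difference = solve-∀

record ClosedTrail {n m} (G : Graph n m) (E : Fin m → Set) : Set where
  field
    len       : ℕ
    len>0     : 0 < len
    V         : ℕ → Fin n
    C         : ℕ → Fin m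
    joins     : ∀ α → α < len → Joins G (C α) (V α) (V (suc α))
    closed    : V len ≡ V 0
    distinct  : ∀ α β → α < len → β < len → C α ≡ C β → α ≡ β
    inside    : ∀ α → α < len → E (C α)

module Circulation {n m} {G : Graph n m} {E : Fin m → Set} (T : ClosedTrail G E) where
  open ClosedTrail T

  circulation : Fin m → ℤ
  circulation e = Σ< len (λ α → if does (e ≟ᶠ C α) then direction G (C α) (V α) else + 0)

  private
    if-zeroʳ : ∀ a (c : Bool) s → a ℤ.* (if c then s else + 0) ≡ (if c then a ℤ.* s else + 0)
    if-zeroʳ a true  s = refl
    if-zeroʳ a false s = ℤP.*-zeroʳ a

  circulation-kernel : ∀ v → netIn G circulation v ≡ + 0
  circulation-kernel v = begin
    Σℤ (λ e → inc G v e ℤ.* Σ< len (term e))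
      ≡⟨ Σℤ-cong (λ e → sym (Σ<-scale len (inc G v e) (term e))) ⟩
    Σℤ (λ e → Σ< len (λ α → inc G v e ℤ.* term e α))
      ≡⟨ Σℤ-Σ<-swap len (λ e α → inc G v e ℤ.* term e α) ⟩
    Σ< len (λ α → Σℤ (λ e → inc G v e ℤ.* term e α))
      ≡⟨ Σ<-cong len (λ α _ → trans (Σℤ-cong (λ e → if-zeroʳ (inc G v e) (does (e ≟ᶠ C α)) _))
                                    (Σℤ-indicator (C α) (λ e → inc G v e ℤ.* direction G (C α) (V α)))) ⟩
    Σ< len (λ α → inc G v (C α) ℤ.* direction G (C α) (V α))
      ≡⟨ Σ<-cong len (λ α α<len → trans (ℤP.*-comm (inc G v (C α)) _) (direction-inc G v (joins α α<len))) ⟩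
    Σ< len (λ α → δ (V (suc α)) v ℤ.- δ (V α) v)
      ≡⟨ Σ<-telescope len (λ α → δ (V α) v) ⟩
    δ (V len) v ℤ.- δ (V 0) v
      ≡⟨ cong (λ u → δ u v ℤ.- δ (V 0) v) closed ⟩
    δ (V 0) v ℤ.- δ (V 0) v
      ≡⟨ ℤP.+-inverseʳ (δ (V 0) v) ⟩
    + 0 ∎
    where
    open ≡-Reasoning
    term : Fin m → ℕ → ℤ
    term e α = if does (e ≟ᶠ C α) then direction G (C α) (V α) else + 0

  circulation-on : ∀ α → α < len → circulation (C α) ≡ direction G (C α) (V α)
  circulation-on α α<len =
    trans (Σ<-single len α α<len
             (λ β β<len β≢α → if-false (C α ≟ᶠ C β) (λ eq → β≢α (distinct β α β<len α<len (sym eq)))))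
          (if-true (C α ≟ᶠ C α) refl)

  circulation-off : ∀ e → (∀ α → α < len → ¬ e ≡ C α) → circulation e ≡ + 0
  circulation-off e off = Σ<-zero len (λ α α<len → if-false (e ≟ᶠ C α) (off α α<len))

argmin : ∀ g → 0 < g → (f : ℕ → ℤ) → Σ ℕ λ a → (a < g) × (∀ α → α < g → f a ℤ.≤ f α)
argmin (suc zero)    _ f = 0 , s≤s z≤n , λ { zero _ → ℤP.≤-refl ; (suc α) (s≤s ()) }
argmin (suc (suc g)) _ f with argmin (suc g) (s≤s z≤n) f
... | a , a<1+g , min-a with ℤP.≤-total (f a) (f (suc g))
...   | inj₁ fa≤ = a , ℕP.m<n⇒m<1+n a<1+g , min
  where
  min : ∀ α → α < suc (suc g) → f a ℤ.≤ f α
  min α α<2+g with α ℕ.≟ suc g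
  ... | yes refl = fa≤
  ... | no α≢1+g = min-a α (ℕP.≤∧≢⇒< (ℕP.≤-pred α<2+g) α≢1+g)
...   | inj₂ f≤fa = suc g , ℕP.≤-refl , min
  where
  min : ∀ α → α < suc (suc g) → f (suc g) ℤ.≤ f α
  min α α<2+g with α ℕ.≟ suc g
  ... | yes refl = ℤP.≤-refl
  ... | no α≢1+g = ℤP.≤-trans f≤fa (min-a α (ℕP.≤∧≢⇒< (ℕP.≤-pred α<2+g) α≢1+g))

Fractional : ∀ {m} → ℕ → (Fin m → ℤ) → Fin m → Set
Fractional d x e = (+ 0 ℤ.< x e) × (x e ℤ.< + d)

fractional? : ∀ {m} d (x : Fin m → ℤ) e → Dec (Fractional d x e)
fractional? d x e = (+ 0 ℤP.<? x e) ×-dec (x e ℤP.<? + d)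

record Cancellation {n m} (G : Graph n m) (d : ℕ) (b : Fin n → ℤ) (x : Fin m → ℤ) : Set where
  constructor cancellation
  field
    y          : Fin m → ℤ
    y-box      : InBox d y
    y-solves   : Solves G d b y
    shrinks    : ∀ e → Fractional d y e → Fractional d x e
    kept       : ∀ e → ¬ Fractional d x e → y e ≡ x e
    cancelled  : Fin m
    was-frac   : Fractional d x cancelled
    now-integral : ¬ Fractional d y cancelled

-- Pushing the largest possible multiple t of the circulation of a closed trail
-- of fractional edges keeps A x and the box constraints, and drives the edge
-- with the least slack to 0 or d.
module CancelAlong {n m} (G : Graph n m) (d : ℕ) (b : Fin n → ℤ) (x : Fin m → ℤ)
                   (x-box : InBox d x) (x-solves : Solves G d b x)
                   (T : ClosedTrail G (Fractional d x)) where
  open ClosedTrail T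
  open Circulation T

  -- how far x can be pushed along the trail at its α-th edge
  slack : ℕ → ℤ
  slack α = if does (tail G (C α) ≟ᶠ V α) then + d ℤ.- x (C α) else x (C α)

  slack≥0 : ∀ α → + 0 ℤ.≤ slack α
  slack≥0 α with tail G (C α) ≟ᶠ V α
  ... | yes _ = ℤP.i≤j⇒0≤j-i (proj₂ (x-box (C α)))
  ... | no  _ = proj₁ (x-box (C α))

  a* : ℕ
  a* = proj₁ (argmin len len>0 slack)

  a*<len : a* < len
  a*<len = proj₁ (proj₂ (argmin len len>0 slack))

  t : ℤ
  t = slack a*

  t-least : ∀ α → α < len → t ℤ.≤ slack α
  t-least = proj₂ (proj₂ (argmin len len>0 slack))

  y : Fin m → ℤ
  y e = x e ℤ.+ t ℤ.* circulation e

  y-on : ∀ α → α < len → y (C α) ≡ x (C α) ℤ.+ t ℤ.* direction G (C α) (V α)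
  y-on α α<len = cong (λ c → x (C α) ℤ.+ t ℤ.* c) (circulation-on α α<len)

  y-off : ∀ e → (∀ α → α < len → ¬ e ≡ C α) → y e ≡ x e
  y-off e off = trans (cong (λ c → x e ℤ.+ t ℤ.* c) (circulation-off e off))
                      (trans (cong (λ s → x e ℤ.+ s) (ℤP.*-zeroʳ t)) (ℤP.+-identityʳ (x e)))

  on-trail? : ∀ e → (Σ ℕ λ α → (α < len) × (e ≡ C α)) ⊎ (∀ α → α < len → ¬ e ≡ C α)
  on-trail? e with FP.any? (λ (α : Fin len) → e ≟ᶠ C (toℕ α))
  ... | yes (α , e≡Cα) = inj₁ (toℕ α , FP.toℕ<n α , e≡Cα)
  ... | no  none       = inj₂ λ α α<len e≡Cα →
    none (fromℕ< α<len , subst (λ β → e ≡ C β) (sym (FP.toℕ-fromℕ< α<len)) e≡Cα)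

  y-box-on : ∀ α → α < len → (+ 0 ℤ.≤ y (C α)) × (y (C α) ℤ.≤ + d)
  y-box-on α α<len rewrite y-on α α<len with tail G (C α) ≟ᶠ V α | t-least α α<len
  ... | yes _ | t≤d-x = forwards (x (C α)) (proj₁ (x-box (C α))) (slack≥0 a*) t≤d-x
    where
    forwards : ∀ X → + 0 ℤ.≤ X → + 0 ℤ.≤ t → t ℤ.≤ + d ℤ.- X →
               (+ 0 ℤ.≤ X ℤ.+ t ℤ.* + 1) × (X ℤ.+ t ℤ.* + 1 ℤ.≤ + d)
    forwards X 0≤X 0≤t t≤d-X rewrite ℤP.*-identityʳ t =
      ℤP.+-mono-≤ 0≤X 0≤t ,
      ℤP.≤-trans (ℤP.+-monoʳ-≤ X t≤d-X) (ℤP.≤-reflexive (cancel X (+ d)))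
      where
      cancel : ∀ X D → X ℤ.+ (D ℤ.- X) ≡ D
      cancel = solve-∀
  ... | no _  | t≤x = backwards (x (C α)) (slack≥0 a*) t≤x (proj₂ (x-box (C α)))
    where
    backwards : ∀ X → + 0 ℤ.≤ t → t ℤ.≤ X → X ℤ.≤ + d →
                (+ 0 ℤ.≤ X ℤ.+ t ℤ.* -1ℤ) × (X ℤ.+ t ℤ.* -1ℤ ℤ.≤ + d)
    backwards X 0≤t t≤X X≤d rewrite ℤP.*-comm t -1ℤ | ℤP.-1*i≡-i t =
      ℤP.i≤j⇒0≤j-i t≤X ,
      ℤP.≤-trans (ℤP.≤-trans (ℤP.+-monoʳ-≤ X (ℤP.neg-mono-≤ 0≤t)) (ℤP.≤-reflexive (ℤP.+-identityʳ X))) X≤d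

  y-box : InBox d y
  y-box e with on-trail? e
  ... | inj₁ (α , α<len , refl) = y-box-on α α<len
  ... | inj₂ off = subst (λ c → (+ 0 ℤ.≤ c) × (c ℤ.≤ + d)) (sym (y-off e off)) (x-box e)

  y-solves : Solves G d b y
  y-solves v = begin
    netIn G y v                                             ≡⟨ netIn-+ G x (λ e → t ℤ.* circulation e) v ⟩
    netIn G x v ℤ.+ netIn G (λ e → t ℤ.* circulation e) v   ≡⟨ cong (λ s → netIn G x v ℤ.+ s) (netIn-scale G t circulation v) ⟩
    netIn G x v ℤ.+ t ℤ.* netIn G circulation v             ≡⟨ cong (λ s → netIn G x v ℤ.+ t ℤ.* s) (circulation-kernel v) ⟩
    netIn G x v ℤ.+ t ℤ.* + 0                               ≡⟨ cong (λ s → netIn G x v ℤ.+ s) (ℤP.*-zeroʳ t) ⟩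
    netIn G x v ℤ.+ + 0                                     ≡⟨ ℤP.+-identityʳ _ ⟩
    netIn G x v                                             ≡⟨ x-solves v ⟩
    + d ℤ.* b v                                             ∎
    where open ≡-Reasoning

  shrinks : ∀ e → Fractional d y e → Fractional d x e
  shrinks e y-frac with on-trail? e
  ... | inj₁ (α , α<len , refl) = inside α α<len
  ... | inj₂ off = subst (λ c → (+ 0 ℤ.< c) × (c ℤ.< + d)) (y-off e off) y-frac

  kept : ∀ e → ¬ Fractional d x e → y e ≡ x e
  kept e x-integral with on-trail? e
  ... | inj₁ (α , α<len , refl) = ⊥-elim (x-integral (inside α α<len))
  ... | inj₂ off = y-off e off

  -- at the edge of least slack the push reaches exactly d (forwards) or 0 (backwards)
  now-integral : ¬ Fractional d y (C a*)
  now-integral y-frac = reached (subst (λ c → (+ 0 ℤ.< c) × (c ℤ.< + d)) (y-on a* a*<len) y-frac)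
    where
    reached : ¬ ((+ 0 ℤ.< x (C a*) ℤ.+ t ℤ.* direction G (C a*) (V a*)) ×
                 (x (C a*) ℤ.+ t ℤ.* direction G (C a*) (V a*) ℤ.< + d))
    reached with tail G (C a*) ≟ᶠ V a*
    ... | yes _ = λ frac → ℤP.<-irrefl (to-d (x (C a*)) (+ d)) (proj₂ frac)
      where
      to-d : ∀ X D → X ℤ.+ (D ℤ.- X) ℤ.* + 1 ≡ D
      to-d = solve-∀
    ... | no _  = λ frac → ℤP.<-irrefl (sym (to-0 (x (C a*)))) (proj₁ frac)
      where
      to-0 : ∀ X → X ℤ.+ X ℤ.* -1ℤ ≡ + 0
      to-0 = solve-∀

  result : Cancellation G d b x
  result = cancellation y y-box y-solves shrinks kept (C a*) (inside a* a*<len) now-integral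

leastWitness : {P : ℕ → Set} → (∀ k → Dec (P k)) → ∀ {j} → P j →
               Σ ℕ λ i → P i × (∀ k → k < i → ¬ P k)
leastWitness {P} P? {j} Pj with FP.¬∀⟶∃¬-smallest (suc j) (λ i → ¬ P (toℕ i)) (λ i → ¬? (P? (toℕ i)))
                                (λ none → none (F.fromℕ j) (subst P (sym (FP.toℕ-fromℕ j)) Pj))
... | i , ¬¬Pi , before = toℕ i , decidable-stable (P? (toℕ i)) ¬¬Pi , λ k k<i Pk →
  before (fromℕ< k<i) (subst P (sym (trans (FP.toℕ-inject (fromℕ< k<i)) (FP.toℕ-fromℕ< k<i))) Pk)

divides-zero : ∀ {k z} → z ≡ + 0 → k ℤS.∣ z
divides-zero {k} z≡0 = divides (+ 0) (trans z≡0 (sym (ℤP.*-zeroˡ k)))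

∤-between : ∀ {d a} → + 0 ℤ.< a → a ℤ.< + d → ¬ (+ d ℤS.∣ a)
∤-between {d} {+ suc a} _         (ℤ.+<+ a<d) d∣a = ℕD.>⇒∤ a<d (ℤS.∣⇒∣ᵤ d∣a)
∤-between {d} {+ zero}  (ℤ.+<+ ()) _           _

module FractionalSubgraph {n m} (G : Graph n m) (d : ℕ) (b : Fin n → ℤ) (x : Fin m → ℤ)
                          (x-box : InBox d x) (x-solves : Solves G d b x) where

  Frac : Fin m → Set
  Frac = Fractional d x

  integral-value : ∀ e → ¬ Frac e → (x e ≡ + 0) ⊎ (x e ≡ + d)
  integral-value e integral with x e ℤP.≟ + 0 | x e ℤP.≟ + d
  ... | yes x≡0 | _       = inj₁ x≡0
  ... | no  _   | yes x≡d = inj₂ x≡d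
  ... | no  x≢0 | no  x≢d =
    ⊥-elim (integral (ℤP.≤∧≢⇒< (proj₁ (x-box e)) (λ 0≡x → x≢0 (sym 0≡x)) ,
                      ℤP.≤∧≢⇒< (proj₂ (x-box e)) x≢d))

  -- A vertex at the end of a fractional non-loop edge ℓ is incident to another
  -- fractional edge: otherwise, modulo d, (A x)_v = d b_v reduces to ±x_ℓ ≡ 0,
  -- which is impossible as 0 < x_ℓ < d.
  no-dangling : ∀ v ℓ → Frac ℓ → Incident G v ℓ → ¬ tail G ℓ ≡ head G ℓ →
                Σ (Fin m) λ e → ¬ e ≡ ℓ × Frac e × Incident G v e
  no-dangling v ℓ ℓ-frac ℓ-inc non-loop
    with FP.any? (λ e → ¬? (e ≟ᶠ ℓ) ×-dec (fractional? d x e ×-dec incident? G v e))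
  ... | yes (e , e≢ℓ , e-frac , e-inc) = e , e≢ℓ , e-frac , e-inc
  ... | no  none = ⊥-elim (∤-between (proj₁ ℓ-frac) (proj₂ ℓ-frac) d∣xℓ)
    where
    term : Fin m → ℤ
    term e = inc G v e ℤ.* x e
    d∣term : ∀ e → ¬ e ≡ ℓ → + d ℤS.∣ term e
    d∣term e e≢ℓ with fractional? d x e
    ... | yes e-frac = divides-zero (trans (cong (ℤ._* x e) (inc-nonincident G v e (λ e-inc → none (e , e≢ℓ , e-frac , e-inc))))
                                          (ℤP.*-zeroˡ (x e)))
    ... | no  e-int with integral-value e e-int
    ...   | inj₁ x≡0 = divides-zero (trans (cong (inc G v e ℤ.*_) x≡0) (ℤP.*-zeroʳ (inc G v e)))
    ...   | inj₂ x≡d = subst (λ c → + d ℤS.∣ inc G v e ℤ.* c) (sym x≡d) (ℤS.∣n⇒∣m*n (inc G v e) ℤS.∣-refl)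
    d∣termℓ : + d ℤS.∣ term ℓ
    d∣termℓ = ∣-Σℤ-except term ℓ (divides (b v) (trans (x-solves v) (ℤP.*-comm (+ d) (b v)))) d∣term
    d∣xℓ : + d ℤS.∣ x ℓ
    d∣xℓ = subst (+ d ℤS.∣_) unit (ℤS.∣n⇒∣m*n (inc G v ℓ) d∣termℓ)
      where
      unit : inc G v ℓ ℤ.* term ℓ ≡ x ℓ
      unit = trans (sym (ℤP.*-assoc (inc G v ℓ) (inc G v ℓ) (x ℓ)))
                   (trans (cong (ℤ._* x ℓ) (inc-unit G v ℓ ℓ-inc non-loop)) (ℤP.*-identityˡ (x ℓ)))

  next-edge : ∀ w ℓ → Frac ℓ → Incident G w ℓ →
              Σ (Fin m) λ e → Frac e × Incident G w e × (e ≡ ℓ → tail G ℓ ≡ head G ℓ)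
  next-edge w ℓ ℓ-frac ℓ-inc with tail G ℓ ≟ᶠ head G ℓ
  ... | yes loop = ℓ , ℓ-frac , ℓ-inc , λ _ → loop
  ... | no  non-loop with no-dangling w ℓ ℓ-frac ℓ-inc non-loop
  ...   | e , e≢ℓ , e-frac , e-inc = e , e-frac , e-inc , λ e≡ℓ → ⊥-elim (e≢ℓ e≡ℓ)

  record Position : Set where
    constructor at
    field
      vertex   : Fin n
      edge     : Fin m
      frac     : Frac edge
      incident : Incident G vertex edge

  step : Position → Position
  step (at v ℓ ℓ-frac ℓ-inc) with next-edge (other G ℓ v) ℓ ℓ-frac (joins-incident G (joins-other G ℓ-inc))
  ... | e , e-frac , e-inc , _ = at (other G ℓ v) e e-frac e-inc

  step-backtracks : ∀ p → Position.edge (step p) ≡ Position.edge p →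
                    tail G (Position.edge p) ≡ head G (Position.edge p)
  step-backtracks (at v ℓ ℓ-frac ℓ-inc) with next-edge (other G ℓ v) ℓ ℓ-frac (joins-incident G (joins-other G ℓ-inc))
  ... | _ , _ , _ , backtrack = backtrack

  -- The infinite walk through fractional edges starting along e₀; by the
  -- pigeonhole principle it revisits a vertex, and its first return closes a trail.
  module Walk (e₀ : Fin m) (e₀-frac : Frac e₀) where

    position : ℕ → Position
    position zero    = at (tail G e₀) e₀ e₀-frac (inj₁ refl)
    position (suc a) = step (position a)

    W : ℕ → Fin n
    W a = Position.vertex (position a)

    E : ℕ → Fin m
    E a = Position.edge (position a)

    walk-joins : ∀ a → Joins G (E a) (W a) (W (suc a))
    walk-joins a = subst (Joins G (E a) (W a)) (step-vertex (position a)) (joins-other G (Position.incident (position a)))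
      where
      step-vertex : ∀ p → other G (Position.edge p) (Position.vertex p) ≡ Position.vertex (step p)
      step-vertex (at v ℓ ℓ-frac ℓ-inc) with next-edge (other G ℓ v) ℓ ℓ-frac (joins-incident G (joins-other G ℓ-inc))
      ... | _ = refl

    Returns : ℕ → Set
    Returns j = Σ (Fin j) λ i → W (toℕ i) ≡ W j

    returns? : ∀ j → Dec (Returns j)
    returns? j = FP.any? (λ i → W (toℕ i) ≟ᶠ W j)

    some-return : Σ ℕ Returns
    some-return with FP.pigeonhole (ℕP.n<1+n n) (λ (a : Fin (suc n)) → W (toℕ a))
    ... | i , j , i<j , same = toℕ j , fromℕ< i<j , trans (cong W (FP.toℕ-fromℕ< i<j)) same

    first-return : Σ ℕ λ j → Returns j × (∀ k → k < j → ¬ Returns k)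
    first-return = leastWitness returns? (proj₂ some-return)

    module FirstCycle (i j : ℕ) (i<j : i < j) (returns : W i ≡ W j)
                      (first : ∀ k → k < j → ¬ Returns k) where
      len : ℕ
      len = j ℕ.∸ i

      i+len≡j : i ℕ.+ len ≡ j
      i+len≡j = ℕP.m+[n∸m]≡n (ℕP.<⇒≤ i<j)

      V : ℕ → Fin n
      V α = W (i ℕ.+ α)

      C : ℕ → Fin m
      C α = E (i ℕ.+ α)

      shift-suc : ∀ α → i ℕ.+ suc α ≡ suc (i ℕ.+ α)
      shift-suc α = ℕP.+-suc i α

      -- before the first return all vertices of the walk are distinct
      V-injective : ∀ α α′ → α < α′ → α′ < len → ¬ V α ≡ V α′
      V-injective α α′ α<α′ α′<len Vα≡Vα′ =
        first (i ℕ.+ α′) (subst (i ℕ.+ α′ <_) i+len≡j (ℕP.+-monoʳ-< i α′<len))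
          (fromℕ< i+α<i+α′ , trans (cong W (FP.toℕ-fromℕ< i+α<i+α′)) Vα≡Vα′)
        where
        i+α<i+α′ : i ℕ.+ α < i ℕ.+ α′
        i+α<i+α′ = ℕP.+-monoʳ-< i α<α′

      joins : ∀ α → α < len → Joins G (C α) (V α) (V (suc α))
      joins α _ = subst (λ a → Joins G (C α) (V α) (W a)) (sym (shift-suc α)) (walk-joins (i ℕ.+ α))

      closed : V len ≡ V 0
      closed = trans (cong W i+len≡j) (trans (sym returns) (cong W (sym (ℕP.+-identityʳ i))))

      -- consecutive trail edges differ (unless a loop, which would repeat a vertex);
      -- non-consecutive equal edges would also force a repeated vertex
      distinct< : ∀ α β → α < β → β < len → ¬ C α ≡ C β
      distinct< α β α<β β<len Cα≡Cβ with suc α ℕ.≟ β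
      ... | yes refl =
        V-injective α (suc α) α<β β<len
          (sym (joins-loop G (joins α (ℕP.<-trans α<β β<len))
                 (step-backtracks (position (i ℕ.+ α)) (trans (cong E (sym (shift-suc α))) (sym Cα≡Cβ)))))
      ... | no 1+α≢β with joins-shared G (joins α (ℕP.<-trans α<β β<len))
                            (subst (λ e → Joins G e (V β) (V (suc β))) (sym Cα≡Cβ) (joins β β<len))
      ...   | inj₁ Vα≡Vβ   = V-injective α β α<β β<len Vα≡Vβ
      ...   | inj₂ V1+α≡Vβ = V-injective (suc α) β (ℕP.≤∧≢⇒< α<β 1+α≢β) β<len V1+α≡Vβ

      distinct : ∀ α β → α < len → β < len → C α ≡ C β → α ≡ β
      distinct α β α<len β<len Cα≡Cβ with ℕP.<-cmp α β
      ... | tri< α<β _ _ = ⊥-elim (distinct< α β α<β β<len Cα≡Cβ)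
      ... | tri≈ _ α≡β _ = α≡β
      ... | tri> _ _ β<α = ⊥-elim (distinct< β α β<α α<len (sym Cα≡Cβ))

      trail : ClosedTrail G Frac
      trail = record
        { len = len ; len>0 = ℕP.m<n⇒0<n∸m i<j ; V = V ; C = C ; joins = joins ; closed = closed
        ; distinct = distinct ; inside = λ α _ → Position.frac (position (i ℕ.+ α)) }

  fractional-trail : ∀ e₀ → Frac e₀ → ClosedTrail G Frac
  fractional-trail e₀ e₀-frac with Walk.first-return e₀ e₀-frac
  ... | j , (i , returns) , first =
    Walk.FirstCycle.trail e₀ e₀-frac (toℕ i) j (FP.toℕ<n i) returns first

count : ∀ {m} {P : Fin m → Set} → (∀ e → Dec (P e)) → ℕ
count {zero}  P? = 0
count {suc m} P? = (if does (P? zero) then 1 else 0) ℕ.+ count (λ e → P? (suc e))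

count-pos : ∀ {m} {P : Fin m → Set} (P? : ∀ e → Dec (P e)) e → P e → 1 ≤ count P?
count-pos P? zero    p with P? zero
... | yes _ = s≤s z≤n
... | no ¬p = ⊥-elim (¬p p)
count-pos P? (suc e) p with P? zero
... | yes _ = s≤s z≤n
... | no  _ = count-pos (λ e → P? (suc e)) e p

count-mono : ∀ {m} {P Q : Fin m → Set} (P? : ∀ e → Dec (P e)) (Q? : ∀ e → Dec (Q e)) →
             (∀ e → Q e → P e) → count Q? ≤ count P?
count-mono {zero}  P? Q? Q⊆P = z≤n
count-mono {suc m} P? Q? Q⊆P with P? zero | Q? zero | count-mono (λ e → P? (suc e)) (λ e → Q? (suc e)) (λ e → Q⊆P (suc e))
... | yes _ | yes _ | rest = s≤s rest
... | no ¬p | yes q | _    = ⊥-elim (¬p (Q⊆P zero q))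
... | yes _ | no  _ | rest = ℕP.m≤n⇒m≤1+n rest
... | no  _ | no  _ | rest = rest

count-strict : ∀ {m} {P Q : Fin m → Set} (P? : ∀ e → Dec (P e)) (Q? : ∀ e → Dec (Q e)) →
               (∀ e → Q e → P e) → ∀ e* → P e* → ¬ Q e* → count Q? < count P?
count-strict {suc m} P? Q? Q⊆P zero p ¬q with P? zero | Q? zero
... | _     | yes q = ⊥-elim (¬q q)
... | no ¬p | no _  = ⊥-elim (¬p p)
... | yes _ | no _  = s≤s (count-mono (λ e → P? (suc e)) (λ e → Q? (suc e)) (λ e → Q⊆P (suc e)))
count-strict {suc m} P? Q? Q⊆P (suc e*) p ¬q
  with P? zero | Q? zero | count-strict (λ e → P? (suc e)) (λ e → Q? (suc e)) (λ e → Q⊆P (suc e)) e* p ¬q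
... | yes _ | yes _ | rest = s≤s rest
... | no ¬p | yes q | _    = ⊥-elim (¬p (Q⊆P zero q))
... | yes _ | no  _ | rest = ℕP.m≤n⇒m≤1+n rest
... | no  _ | no  _ | rest = rest

ZeroOne : ∀ {m} → (Fin m → ℤ) → Set
ZeroOne z = ∀ e → (z e ≡ + 0) ⊎ (z e ≡ + 1)

ZeroOneSolution : ∀ {n m} → Graph n m → (Fin n → ℤ) → (Fin m → ℤ) → Set
ZeroOneSolution G b z = ZeroOne z × (∀ v → netIn G z v ≡ b v)

record Rounding {n m} (G : Graph n m) (d : ℕ) (b : Fin n → ℤ) (x : Fin m → ℤ) : Set where
  constructor rounding
  field
    z        : Fin m → ℤ
    zero-one : ZeroOne z
    z-solves : ∀ v → netIn G z v ≡ b v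
    down     : ∀ e → x e ≡ + 0 → z e ≡ + 0
    up       : ∀ e → x e ≡ + d → z e ≡ + 1

module _ {n m} (G : Graph n m) (d : ℕ) (1≤d : 1 ≤ d) (b : Fin n → ℤ) where

  integral-rounding : ∀ x → InBox d x → Solves G d b x → (∀ e → ¬ Fractional d x e) → Rounding G d b x
  integral-rounding x x-box x-solves integral = rounding z zero-one z-solves down up
    where
    open FractionalSubgraph G d b x x-box x-solves using (integral-value)
    z : Fin m → ℤ
    z e = if does (x e ℤP.≟ + d) then + 1 else + 0
    zero-one : ZeroOne z
    zero-one e with x e ℤP.≟ + d
    ... | yes _ = inj₂ refl
    ... | no  _ = inj₁ refl
    x≡dz : ∀ e → x e ≡ + d ℤ.* z e
    x≡dz e with x e ℤP.≟ + d | integral-value e (integral e)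
    ... | yes x≡d | _        = trans x≡d (sym (ℤP.*-identityʳ (+ d)))
    ... | no  _   | inj₁ x≡0 = trans x≡0 (sym (ℤP.*-zeroʳ (+ d)))
    ... | no  x≢d | inj₂ x≡d = ⊥-elim (x≢d x≡d)
    z-solves : ∀ v → netIn G z v ≡ b v
    z-solves v = ℤP.*-cancelˡ-≡ (+ d) (netIn G z v) (b v) {{ℕ.>-nonZero 1≤d}}
      (trans (sym (netIn-scale G (+ d) z v)) (trans (sym (netIn-cong G x≡dz v)) (x-solves v)))
    down : ∀ e → x e ≡ + 0 → z e ≡ + 0
    down e x≡0 with x e ℤP.≟ + d
    ... | yes x≡d = ⊥-elim (ℕP.<⇒≢ 1≤d (ℤP.+-injective (trans (sym x≡0) x≡d)))
    ... | no  _   = refl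
    up : ∀ e → x e ≡ + d → z e ≡ + 1
    up e x≡d with x e ℤP.≟ + d
    ... | yes _   = refl
    ... | no  x≢d = ⊥-elim (x≢d x≡d)

  -- Integrality: every solution x ∈ [0, d]^E of A x = d b can be rounded to a
  -- 0/1 solution of A z = b, by cancelling cycles until no fractional edge is left.
  round : ∀ x → InBox d x → Solves G d b x → Rounding G d b x
  round x x-box x-solves = by-count (count (fractional? d x)) x ℕP.≤-refl x-box x-solves
    where
    by-count : ∀ k x → count (fractional? d x) ≤ k → InBox d x → Solves G d b x → Rounding G d b x
    after-cancelling : ∀ k x → count (fractional? d x) ≤ k → ∀ e₀ → Fractional d x e₀ →
                       Cancellation G d b x → Rounding G d b x

    by-count k x count≤k x-box x-solves with FP.any? (fractional? d x)
    ... | no  none = integral-rounding x x-box x-solves (λ e e-frac → none (e , e-frac))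
    ... | yes (e₀ , e₀-frac) =
      after-cancelling k x count≤k e₀ e₀-frac
        (CancelAlong.result G d b x x-box x-solves
          (FractionalSubgraph.fractional-trail G d b x x-box x-solves e₀ e₀-frac))

    after-cancelling zero x count≤0 e₀ e₀-frac _ =
      ⊥-elim (ℕP.<-irrefl refl (ℕP.≤-trans (count-pos (fractional? d x) e₀ e₀-frac) count≤0))
    after-cancelling (suc k) x count≤1+k _ _ (cancellation y y-box y-solves shrinks kept e* was-frac now-integral)
      with by-count k y (ℕP.≤-pred (ℕP.<-≤-trans (count-strict (fractional? d x) (fractional? d y) shrinks e* was-frac now-integral)
                                                  count≤1+k))
                    y-box y-solves
    ... | rounding z zero-one z-solves down up =
      rounding z zero-one z-solves
        (λ e x≡0 → down e (trans (kept e (λ frac → ℤP.<-irrefl (sym x≡0) (proj₁ frac))) x≡0))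
        (λ e x≡d → up e (trans (kept e (λ frac → ℤP.<-irrefl x≡d (proj₂ frac))) x≡d))

private
  peel-0 : ∀ X k → + 0 ℤ.≤ X → X ℤ.< + suc k → X ℤ.≤ + k
  peel-0 (+ _)    k _  (ℤ.+<+ (s≤s X≤k)) = ℤ.+≤+ X≤k
  peel-0 -[1+ _ ] k () _

  0≢1 : ¬ (+ 0 ≡ + 1)
  0≢1 ()

  peel-1 : ∀ X k → + 0 ℤ.< X → X ℤ.≤ + suc k → (+ 0 ℤ.≤ X ℤ.- + 1) × (X ℤ.- + 1 ℤ.≤ + k)
  peel-1 (+ suc X) k _          (ℤ.+≤+ (s≤s X≤k)) = ℤ.+≤+ z≤n , ℤ.+≤+ X≤k
  peel-1 (+ zero)  k (ℤ.+<+ ()) _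
  peel-1 -[1+ _ ]  k ()         _

-- If x ∈ [0, d]^E solves A x = d b and x_e > 0, then some 0/1 solution of
-- A z = b has z_e = 1. By induction on d: peel off a rounding z of x; if z_e = 0
-- then x - z ∈ [0, d - 1]^E solves A (x - z) = (d - 1) b and is still positive at e.
one-at : ∀ {n m} (G : Graph n m) d b (x : Fin m → ℤ) → InBox d x → Solves G d b x →
         ∀ e → + 0 ℤ.< x e → Σ (Fin m → ℤ) λ z → ZeroOneSolution G b z × (z e ≡ + 1)
one-at G zero b x x-box x-solves e 0<xe = ⊥-elim (ℤP.<-irrefl refl (ℤP.<-≤-trans 0<xe (proj₂ (x-box e))))
one-at {m = m} G (suc d) b x x-box x-solves e 0<xe
  with round G (suc d) (s≤s z≤n) b x x-box x-solves
... | rounding z zero-one z-solves down up with zero-one e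
...   | inj₂ ze≡1 = z , (zero-one , z-solves) , ze≡1
...   | inj₁ ze≡0 = one-at G d b y y-box y-solves e 0<ye
  where
  y : Fin m → ℤ
  y e′ = x e′ ℤ.- z e′
  y-box : InBox d y
  y-box e′ with zero-one e′
  ... | inj₁ z≡0 = subst (λ c → (+ 0 ℤ.≤ c) × (c ℤ.≤ + d)) (sym y≡x)
                     (proj₁ (x-box e′) , peel-0 (x e′) d (proj₁ (x-box e′)) x<1+d)
    where
    y≡x : y e′ ≡ x e′
    y≡x = trans (cong (λ c → x e′ ℤ.- c) z≡0) (ℤP.+-identityʳ (x e′))
    x<1+d : x e′ ℤ.< + suc d
    x<1+d = ℤP.≤∧≢⇒< (proj₂ (x-box e′)) (λ x≡d → 0≢1 (trans (sym z≡0) (up e′ x≡d)))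
  ... | inj₂ z≡1 = subst (λ c → (+ 0 ℤ.≤ c) × (c ℤ.≤ + d)) (sym y≡x-1) (peel-1 (x e′) d 0<x (proj₂ (x-box e′)))
    where
    y≡x-1 : y e′ ≡ x e′ ℤ.- + 1
    y≡x-1 = cong (λ c → x e′ ℤ.- c) z≡1
    0<x : + 0 ℤ.< x e′
    0<x = ℤP.≤∧≢⇒< (proj₁ (x-box e′)) (λ 0≡x → 0≢1 (trans (sym (down e′ (sym 0≡x))) z≡1))
  y-solves : Solves G d b y
  y-solves v = trans (netIn-- G x z v) (trans (cong₂ ℤ._-_ (x-solves v) (z-solves v)) (peel (+ d) (b v)))
    where
    peel : ∀ D B → (+ 1 ℤ.+ D) ℤ.* B ℤ.- B ≡ D ℤ.* B
    peel = solve-∀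
  0<ye : + 0 ℤ.< y e
  0<ye = subst (+ 0 ℤ.<_) (sym (trans (cong (λ c → x e ℤ.- c) ze≡0) (ℤP.+-identityʳ (x e)))) 0<xe

𝟙 : ∀ {m} → Fin m → ℤ
𝟙 _ = + 1

-- Dually, if x_e < d then some 0/1 solution has z_e = 0: apply one-at to the
-- complementary solution d·1 - x of A y = d (A 1 - b) and complement the result.
zero-at : ∀ {n m} (G : Graph n m) d b (x : Fin m → ℤ) → InBox d x → Solves G d b x →
          ∀ e → x e ℤ.< + d → Σ (Fin m → ℤ) λ z → ZeroOneSolution G b z × (z e ≡ + 0)
zero-at {m = m} G d b x x-box x-solves e xe<d with one-at G d b′ y y-box y-solves e 0<ye
  where
  b′ : Fin _ → ℤ
  b′ v = netIn G 𝟙 v ℤ.- b v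
  y : Fin m → ℤ
  y e′ = + d ℤ.- x e′
  y-box : InBox d y
  y-box e′ = ℤP.i≤j⇒0≤j-i (proj₂ (x-box e′)) ,
             ℤP.≤-trans (ℤP.+-monoʳ-≤ (+ d) (ℤP.neg-mono-≤ (proj₁ (x-box e′)))) (ℤP.≤-reflexive (ℤP.+-identityʳ (+ d)))
  y-solves : Solves G d b′ y
  y-solves v = begin
    netIn G y v                                             ≡⟨ netIn-cong G (λ e′ → cong (ℤ._- x e′) (sym (ℤP.*-identityʳ (+ d)))) v ⟩
    netIn G (λ e′ → + d ℤ.* 𝟙 e′ ℤ.- x e′) v                ≡⟨ netIn-- G (λ e′ → + d ℤ.* 𝟙 e′) x v ⟩
    netIn G (λ e′ → + d ℤ.* 𝟙 e′) v ℤ.- netIn G x v         ≡⟨ cong₂ ℤ._-_ (netIn-scale G (+ d) 𝟙 v) (x-solves v) ⟩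
    + d ℤ.* netIn G 𝟙 v ℤ.- + d ℤ.* b v                     ≡⟨ factor (+ d) (netIn G 𝟙 v) (b v) ⟩
    + d ℤ.* b′ v                                            ∎
    where
    open ≡-Reasoning
    factor : ∀ D N B → D ℤ.* N ℤ.- D ℤ.* B ≡ D ℤ.* (N ℤ.- B)
    factor = solve-∀
  0<ye : + 0 ℤ.< y e
  0<ye = subst (ℤ._< y e) (ℤP.+-inverseʳ (x e)) (ℤP.+-monoˡ-< (ℤ.- x e) xe<d)
... | z′ , (zero-one′ , z′-solves) , z′e≡1 = z , (zero-one , z-solves) , ze≡0
  where
  z : Fin m → ℤ
  z e′ = + 1 ℤ.- z′ e′
  zero-one : ZeroOne z
  zero-one e′ with zero-one′ e′
  ... | inj₁ z′≡0 rewrite z′≡0 = inj₂ refl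
  ... | inj₂ z′≡1 rewrite z′≡1 = inj₁ refl
  z-solves : ∀ v → netIn G z v ≡ b v
  z-solves v = trans (netIn-- G 𝟙 z′ v)
                     (trans (cong (λ c → netIn G 𝟙 v ℤ.- c) (z′-solves v)) (cancel (netIn G 𝟙 v) (b v)))
    where
    cancel : ∀ N B → N ℤ.- (N ℤ.- B) ≡ B
    cancel = solve-∀
  ze≡0 : z e ≡ + 0
  ze≡0 rewrite z′e≡1 = refl

vectorsOver : {A : Set} → List A → (m : ℕ) → List (Vec A m)
vectorsOver xs zero    = L.[ [] ]
vectorsOver xs (suc m) = cartesianProductWith _∷_ xs (vectorsOver xs m)

∈-vectorsOver⁺ : {A : Set} (xs : List A) (m : ℕ) (v : Vec A m) → (∀ e → lookup v e ∈ xs) → v ∈ vectorsOver xs m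
∈-vectorsOver⁺ xs zero    []      _   = here refl
∈-vectorsOver⁺ xs (suc m) (a ∷ v) v∈ =
  ∈-cartesianProductWith⁺ _∷_ (v∈ zero) (∈-vectorsOver⁺ xs m v (λ e → v∈ (suc e)))

∈-vectorsOver⁻ : {A : Set} (xs : List A) (m : ℕ) (v : Vec A m) → v ∈ vectorsOver xs m → ∀ e → lookup v e ∈ xs
∈-vectorsOver⁻ xs (suc m) v v∈ e with ∈-cartesianProductWith⁻ _∷_ xs (vectorsOver xs m) v∈
... | a , w , a∈ , w∈ , refl = entry e
  where
  entry : ∀ e → lookup (a ∷ w) e ∈ xs
  entry zero    = a∈
  entry (suc e) = ∈-vectorsOver⁻ xs m w w∈ e

vectorsOver-unique : {A : Set} (xs : List A) (m : ℕ) → Unique xs → Unique (vectorsOver xs m)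
vectorsOver-unique xs zero    _        = All.[] AP.∷ AP.[]
vectorsOver-unique xs (suc m) xs-unique =
  UP.cartesianProductWith⁺ _∷_ VP.∷-injective xs-unique (vectorsOver-unique xs m xs-unique)

bits : List ℤ
bits = + 0 L.∷ + 1 L.∷ L.[]

∈-bits⁻ : ∀ {a} → a ∈ bits → (a ≡ + 0) ⊎ (a ≡ + 1)
∈-bits⁻ (here a≡0)         = inj₁ a≡0
∈-bits⁻ (there (here a≡1)) = inj₂ a≡1

∈-bits⁺ : ∀ {a} → (a ≡ + 0) ⊎ (a ≡ + 1) → a ∈ bits
∈-bits⁺ (inj₁ a≡0) = here a≡0
∈-bits⁺ (inj₂ a≡1) = there (here a≡1)

sumAll : ∀ {m} → List (Vec ℤ m) → Fin m → ℤ
sumAll L.[]       e = + 0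
sumAll (z L.∷ zs) e = lookup z e ℤ.+ sumAll zs e

module _ {m} (e : Fin m) where

  BitsAt : List (Vec ℤ m) → Set
  BitsAt zs = ∀ {z} → z ∈ zs → (lookup z e ≡ + 0) ⊎ (lookup z e ≡ + 1)

  private
    bit≥0 : ∀ {a} → (a ≡ + 0) ⊎ (a ≡ + 1) → + 0 ℤ.≤ a
    bit≥0 (inj₁ refl) = ℤP.≤-refl
    bit≥0 (inj₂ refl) = ℤ.+≤+ z≤n

    bit≤1 : ∀ {a} → (a ≡ + 0) ⊎ (a ≡ + 1) → a ℤ.≤ + 1
    bit≤1 (inj₁ refl) = ℤ.+≤+ z≤n
    bit≤1 (inj₂ refl) = ℤP.≤-refl

  sumAll≥0 : ∀ zs → BitsAt zs → + 0 ℤ.≤ sumAll zs e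
  sumAll≥0 L.[]       bits = ℤP.≤-refl
  sumAll≥0 (z L.∷ zs) bits = ℤP.+-mono-≤ (bit≥0 (bits (here refl))) (sumAll≥0 zs (λ z∈ → bits (there z∈)))

  sumAll≤length : ∀ zs → BitsAt zs → sumAll zs e ℤ.≤ + length zs
  sumAll≤length L.[]       bits = ℤP.≤-refl
  sumAll≤length (z L.∷ zs) bits = ℤP.+-mono-≤ (bit≤1 (bits (here refl))) (sumAll≤length zs (λ z∈ → bits (there z∈)))

  sumAll>0 : ∀ zs → BitsAt zs → Any (λ z → lookup z e ≡ + 1) zs → + 0 ℤ.< sumAll zs e
  sumAll>0 (z L.∷ zs) bits (here z≡1) rewrite z≡1 =
    ℤP.+-mono-<-≤ (ℤ.+<+ (s≤s z≤n)) (sumAll≥0 zs (λ z∈ → bits (there z∈)))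
  sumAll>0 (z L.∷ zs) bits (there one) =
    ℤP.+-mono-≤-< (bit≥0 (bits (here refl))) (sumAll>0 zs (λ z∈ → bits (there z∈)) one)

  sumAll<length : ∀ zs → BitsAt zs → Any (λ z → lookup z e ≡ + 0) zs → sumAll zs e ℤ.< + length zs
  sumAll<length (z L.∷ zs) bits (here z≡0) rewrite z≡0 =
    ℤP.+-mono-<-≤ (ℤ.+<+ (s≤s z≤n)) (sumAll≤length zs (λ z∈ → bits (there z∈)))
  sumAll<length (z L.∷ zs) bits (there nought) =
    ℤP.+-mono-≤-< (bit≤1 (bits (here refl))) (sumAll<length zs (λ z∈ → bits (there z∈)) nought)

∈⇒nonempty : {A : Set} {a : A} {xs : List A} → a ∈ xs → 1 ≤ length xs
∈⇒nonempty (here _)  = s≤s z≤n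
∈⇒nonempty (there _) = s≤s z≤n

nonempty⇒∈ : {A : Set} (xs : List A) → 1 ≤ length xs → Σ A (_∈ xs)
nonempty⇒∈ (a L.∷ _) _ = a , here refl

vector-ext : ∀ {A : Set} {k} {u w : Vec A k} → (∀ i → lookup u i ≡ lookup w i) → u ≡ w
vector-ext {u = u} {w} u≗w = trans (sym (VP.tabulate∘lookup u)) (trans (VP.tabulate-cong u≗w) (VP.tabulate∘lookup w))

module BoundarySet {n m} (G : Graph n m) where

  netInV : Vec ℤ m → Vec ℤ n
  netInV z = tabulate (netIn G (lookup z))

  solves? : ∀ b (z : Vec ℤ m) → Dec (∀ v → netIn G (lookup z) v ≡ lookup b v)
  solves? b z = FP.all? (λ v → netIn G (lookup z) v ℤP.≟ lookup b v)

  S : Vec ℤ n → List (Vec ℤ m)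
  S b = filter (solves? b) (vectorsOver bits m)

  ∈S⁻ : ∀ b {z} → z ∈ S b → ZeroOneSolution G (lookup b) (lookup z)
  ∈S⁻ b {z} z∈ with ∈-filter⁻ (solves? b) z∈
  ... | z∈bits , z-solves = (λ e → ∈-bits⁻ (∈-vectorsOver⁻ bits m z z∈bits e)) , z-solves

  ∈S⁺ : ∀ b z → ZeroOneSolution G (lookup b) z → tabulate z ∈ S b
  ∈S⁺ b z (zero-one , z-solves) =
    ∈-filter⁺ (solves? b)
      (∈-vectorsOver⁺ bits m (tabulate z) (λ e → subst (_∈ bits) (sym (VP.lookup∘tabulate z e)) (∈-bits⁺ (zero-one e))))
      (λ v → trans (netIn-cong G (VP.lookup∘tabulate z) v) (z-solves v))

  Certified : Vec ℤ n → Set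
  Certified b = (1 ≤ length (S b)) ×
                (∀ e → Any (λ z → lookup z e ≡ + 1) (S b) × Any (λ z → lookup z e ≡ + 0) (S b))

  certified? : ∀ b → Dec (Certified b)
  certified? b = (1 ℕ.≤? length (S b)) ×-dec
                 FP.all? (λ e → Any.any? (λ z → lookup z e ℤP.≟ + 1) (S b) ×-dec
                                Any.any? (λ z → lookup z e ℤP.≟ + 0) (S b))

  -- The sum of all 0/1 solutions of A z = b is a lattice point of |S(b)| · P°_G(b).
  certified⇒InB : ∀ b → Certified b → InB G b
  certified⇒InB b (nonempty , both) =
    lattice⇒InB G b (length (S b)) nonempty (sumAll (S b)) solves inside
    where
    bitsAt : ∀ e → BitsAt e (S b)
    bitsAt e z∈ = proj₁ (∈S⁻ b z∈) e
    sum-solves : ∀ zs → (∀ {z} → z ∈ zs → z ∈ S b) → Solves G (length zs) (lookup b) (sumAll zs)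
    sum-solves L.[]       _   v =
      trans (Σℤ-cong (λ e → ℤP.*-zeroʳ (inc G v e))) (trans (Σℤ-zero m) (sym (ℤP.*-zeroˡ (lookup b v))))
    sum-solves (z L.∷ zs) ⊆S v =
      trans (netIn-+ G (lookup z) (sumAll zs) v)
            (trans (cong₂ ℤ._+_ (proj₂ (∈S⁻ b (⊆S (here refl))) v) (sum-solves zs (λ z∈ → ⊆S (there z∈)) v))
                   (one-more (lookup b v) (+ length zs)))
      where
      one-more : ∀ B L → B ℤ.+ L ℤ.* B ≡ (+ 1 ℤ.+ L) ℤ.* B
      one-more = solve-∀
    solves : Solves G (length (S b)) (lookup b) (sumAll (S b))
    solves = sum-solves (S b) (λ z∈ → z∈)
    inside : InOpenBox (length (S b)) (sumAll (S b))
    inside e = sumAll>0 e (S b) (bitsAt e) (proj₁ (both e)) , sumAll<length e (S b) (bitsAt e) (proj₂ (both e))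

  -- Conversely, from a lattice point x of d · P°_G(b) the rounding lemmas produce
  -- 0/1 solutions taking both values at every edge.
  InB⇒certified : ∀ b → InB G b → Certified b
  InB⇒certified b b∈B = from-lattice (InB⇒lattice G b b∈B)
    where
    witness : ∀ {P : Vec ℤ m → Set} {z} → ZeroOneSolution G (lookup b) z → P (tabulate z) → Any P (S b)
    witness {P} {z} sol Pz = Any.map (λ eq → subst P eq Pz) (∈S⁺ b z sol)
    from-lattice : (Σ ℕ λ d → (1 ≤ d) × Σ (Fin m → ℤ) λ x → Solves G d (lookup b) x × InOpenBox d x) → Certified b
    from-lattice (d , 1≤d , x , x-solves , x-inside) = nonempty , both
      where
      x-box : InBox d x
      x-box = openBox⇒box x-inside
      r : Rounding G d (lookup b) x
      r = round G d 1≤d (lookup b) x x-box x-solves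
      nonempty : 1 ≤ length (S b)
      nonempty = ∈⇒nonempty (∈S⁺ b (Rounding.z r) (Rounding.zero-one r , Rounding.z-solves r))
      both : ∀ e → Any (λ z → lookup z e ≡ + 1) (S b) × Any (λ z → lookup z e ≡ + 0) (S b)
      both e = at-one (one-at G d (lookup b) x x-box x-solves e (proj₁ (x-inside e))) ,
               at-zero (zero-at G d (lookup b) x x-box x-solves e (proj₂ (x-inside e)))
        where
        at-one : (Σ (Fin m → ℤ) λ z → ZeroOneSolution G (lookup b) z × (z e ≡ + 1)) →
                 Any (λ z → lookup z e ≡ + 1) (S b)
        at-one (z , sol , ze≡1) = witness sol (trans (VP.lookup∘tabulate z e) ze≡1)
        at-zero : (Σ (Fin m → ℤ) λ z → ZeroOneSolution G (lookup b) z × (z e ≡ + 0)) →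
                  Any (λ z → lookup z e ≡ + 0) (S b)
        at-zero (z , sol , ze≡0) = witness sol (trans (VP.lookup∘tabulate z e) ze≡0)

  candidates : List (Vec ℤ n)
  candidates = deduplicate (VP.≡-dec ℤP._≟_) (map netInV (vectorsOver bits m))

  ∈S⇒candidate : ∀ b {z} → z ∈ S b → b ∈ candidates
  ∈S⇒candidate b {z} z∈ =
    subst (_∈ candidates) (vector-ext (λ v → trans (VP.lookup∘tabulate _ v) (proj₂ (∈S⁻ b z∈) v)))
      (∈-deduplicate⁺ (VP.≡-dec ℤP._≟_) (∈-map⁺ netInV (proj₁ (∈-filter⁻ (solves? b) z∈))))

  boundaries : List (Vec ℤ n)
  boundaries = filter certified? candidates

  boundaries-unique : Unique boundaries
  boundaries-unique =
    UP.filter⁺ certified? {xs = candidates} (UDP.deduplicate-! (VP.≡-dec ℤP._≟_) (map netInV (vectorsOver bits m)))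

  ∈boundaries⇔InB : ∀ b → (b ∈ boundaries) ⇔ InB G b
  ∈boundaries⇔InB b = mk⇔ (λ b∈ → certified⇒InB b (proj₂ (∈-filter⁻ certified? {xs = candidates} b∈))) to
    where
    to : InB G b → b ∈ boundaries
    to b∈B = ∈-filter⁺ certified? (∈S⇒candidate b (proj₂ (nonempty⇒∈ (S b) (proj₁ certified)))) certified
      where
      certified : Certified b
      certified = InB⇒certified b b∈B

length-concatMap : {A B : Set} (h : A → List B) (xs : List A) →
                   length (concatMap h xs) ≡ V.sum (tabulate (λ i → length (h (L.lookup xs i))))
length-concatMap h L.[]       = refl
length-concatMap h (a L.∷ xs) = trans (LP.length-++ (h a)) (cong (length (h a) ℕ.+_) (length-concatMap h xs))

lift : ∀ {k m} → Vec (Fin k) m → Vec ℤ m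
lift = V.map (λ c → + toℕ c)

lookup-lift : ∀ {k m} (f : Vec (Fin k) m) e → lookup (lift f) e ≡ + toℕ (lookup f e)
lookup-lift f e = VP.lookup-map e (λ c → + toℕ c) f

lift-injective : ∀ {k m} {f f′ : Vec (Fin k) m} → lift f ≡ lift f′ → f ≡ f′
lift-injective {f = f} {f′} eq = vector-ext λ e →
  FP.toℕ-injective (ℤP.+-injective (trans (sym (lookup-lift f e)) (trans (cong (λ x → lookup x e) eq) (lookup-lift f′ e))))

lift-inside : ∀ {k m} (f : Vec (Fin k) m) → NowhereZero f → InOpenBox k (lookup (lift f))
lift-inside f nz e rewrite lookup-lift f e = ℤ.+<+ (ℕP.n≢0⇒n>0 (nz e)) , ℤ.+<+ (FP.toℕ<n (lookup f e))

inside-lift : ∀ {k m} (x : Vec ℤ m) → InOpenBox k (lookup x) → Σ (Vec (Fin k) m) λ f → NowhereZero f × lift f ≡ x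
inside-lift {k} x inside =
  f , nz , vector-ext λ e → trans (lookup-lift f e) (trans (cong (λ c → + toℕ c) (VP.lookup∘tabulate _ e)) (digit-value e))
  where
  digit : ∀ (a : ℤ) → + 0 ℤ.< a → a ℤ.< + k → Fin k
  digit (+ j) _ (ℤ.+<+ j<k) = fromℕ< j<k
  digit-toℕ : ∀ a 0<a a<k → + toℕ (digit a 0<a a<k) ≡ a
  digit-toℕ (+ j) _ (ℤ.+<+ j<k) = cong +_ (FP.toℕ-fromℕ< j<k)
  f : Vec (Fin k) _
  f = tabulate (λ e → digit (lookup x e) (proj₁ (inside e)) (proj₂ (inside e)))
  digit-value : ∀ e → + toℕ (digit (lookup x e) (proj₁ (inside e)) (proj₂ (inside e))) ≡ lookup x e
  digit-value e = digit-toℕ (lookup x e) (proj₁ (inside e)) (proj₂ (inside e))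
  nz : NowhereZero f
  nz e toℕ≡0 = ℤP.<-irrefl (sym x≡0) (proj₁ (inside e))
    where
    x≡0 : lookup x e ≡ + 0
    x≡0 = trans (sym (digit-value e)) (trans (cong (λ c → + toℕ c) (sym (VP.lookup∘tabulate _ e))) (cong +_ toℕ≡0))

module FlowCount {n m} (G : Graph n m) (k : ℕ) (1≤k : 1 ≤ k) where
  open BoundarySet G

  LiftSolves : Vec ℤ n → Vec (Fin k) m → Set
  LiftSolves b f = Solves G k (lookup b) (lookup (lift f))

  liftSolves? : ∀ b f → Dec (LiftSolves b f)
  liftSolves? b f = FP.all? (λ v → netIn G (lookup (lift f)) v ℤP.≟ + k ℤ.* lookup b v)

  nowhereZero? : (f : Vec (Fin k) m) → Dec (NowhereZero f)
  nowhereZero? f = FP.all? (λ e → ¬? (toℕ (lookup f e) ℕ.≟ 0))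

  flowsAt : Vec ℤ n → List (Vec (Fin k) m)
  flowsAt b = filter (λ f → nowhereZero? f ×-dec liftSolves? b f) (vectorsOver (allFin k) m)

  flowsAt-unique : ∀ b → Unique (flowsAt b)
  flowsAt-unique b = UP.filter⁺ (λ f → nowhereZero? f ×-dec liftSolves? b f) (vectorsOver-unique (allFin k) m (UP.allFin⁺ k))

  ∈flowsAt⁻ : ∀ b {f} → f ∈ flowsAt b → NowhereZero f × LiftSolves b f
  ∈flowsAt⁻ b f∈ = proj₂ (∈-filter⁻ (λ f → nowhereZero? f ×-dec liftSolves? b f) {xs = vectorsOver (allFin k) m} f∈)

  ∈flowsAt⁺ : ∀ b f → NowhereZero f → LiftSolves b f → f ∈ flowsAt b
  ∈flowsAt⁺ b f nz solves =
    ∈-filter⁺ (λ f → nowhereZero? f ×-dec liftSolves? b f)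
      (∈-vectorsOver⁺ (allFin k) m f (λ e → ∈-allFin (lookup f e))) (nz , solves)

  dilate-count : ∀ b → IsCount (InDilate G k b) (length (flowsAt b))
  dilate-count b =
    map lift (flowsAt b) , UP.map⁺ lift-injective (flowsAt-unique b) , LP.length-map lift (flowsAt b) ,
    λ x → mk⇔ (to x) (from x)
    where
    to : ∀ x → InDilate G k b x → x ∈ map lift (flowsAt b)
    to x x∈kP with Dilation.InDilate⇒lattice G k 1≤k b x x∈kP
    ... | solves , inside with inside-lift x inside
    ...   | f , nz , refl = ∈-map⁺ lift (∈flowsAt⁺ b f nz solves)
    from : ∀ x → x ∈ map lift (flowsAt b) → InDilate G k b x
    from x x∈ with ∈-map⁻ lift x∈
    ... | f , f∈ , refl =
      Dilation.lattice⇒InDilate G k 1≤k b (lift f) (proj₂ (∈flowsAt⁻ b f∈)) (lift-inside f (proj₁ (∈flowsAt⁻ b f∈)))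

  flows : List (Vec (Fin k) m)
  flows = concatMap flowsAt boundaries

  -- A Z_k-vector is a nowhere-zero Z_k-flow iff it lies in flowsAt b for some b ∈ B_G:
  -- its lift lies in k · P°_G(b), so P°_G(b) is nonempty.
  nzFlow⇔∈flows : ∀ f → IsNZFlow G k f ⇔ (f ∈ flows)
  nzFlow⇔∈flows f = mk⇔ from to
    where
    lifted : ∀ v → netIn G (lookup (lift f)) v ≡ Σℤ (λ e → inc G v e ℤ.* + toℕ (lookup f e))
    lifted = netIn-cong G (lookup-lift f)
    to : f ∈ flows → IsNZFlow G k f
    to f∈ with Any.satisfied (∈-concatMap⁻ flowsAt {xs = boundaries} f∈)
    ... | b , f∈b with ∈flowsAt⁻ b f∈b
    ...   | nz , solves =
      (λ v → ℤS.∣⇒∣ᵤ (divides (lookup b v) (trans (sym (lifted v)) (trans (solves v) (ℤP.*-comm (+ k) (lookup b v)))))) ,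
      nz
    from : IsNZFlow G k f → f ∈ flows
    from (is-flow , nz) =
      ∈-concatMap⁺ flowsAt {xs = boundaries} (Any.map (λ b≡b′ → subst (λ b′ → f ∈ flowsAt b′) b≡b′ f∈b) b∈)
      where
      divisible : ∀ v → + k ℤS.∣ Σℤ (λ e → inc G v e ℤ.* + toℕ (lookup f e))
      divisible v = ℤS.∣ᵤ⇒∣ {+ k} {Σℤ (λ e → inc G v e ℤ.* + toℕ (lookup f e))} (is-flow v)
      quotient : ∀ v → ℤ
      quotient v = ℤS.quotient (divisible v)
      b : Vec ℤ n
      b = tabulate quotient
      solves : LiftSolves b f
      solves v = trans (lifted v) (trans (ℤS._∣_.equality (divisible v))
                                         (trans (ℤP.*-comm (quotient v) (+ k)) (cong (+ k ℤ.*_) (sym (VP.lookup∘tabulate quotient v)))))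
      b∈ : b ∈ boundaries
      b∈ = Equivalence.from (∈boundaries⇔InB b) (lattice⇒InB G b k 1≤k (lookup (lift f)) solves (lift-inside f nz))
      f∈b : f ∈ flowsAt b
      f∈b = ∈flowsAt⁺ b f nz solves

  flows-unique : Unique flows
  flows-unique =
    UP.concat⁺ (AllP.map⁺ (All.tabulate (λ {b} _ → flowsAt-unique b))) (APP.map⁺ (AP.map disjoint boundaries-unique))
    where
    -- A f̂ determines b, since k ≠ 0.
    disjoint : ∀ {b b′} → ¬ b ≡ b′ → Disjoint (flowsAt b) (flowsAt b′)
    disjoint {b} {b′} b≢b′ (f∈b , f∈b′) = b≢b′ (vector-ext λ v →
      ℤP.*-cancelˡ-≡ (+ k) (lookup b v) (lookup b′ v) {{ℕ.>-nonZero 1≤k}}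
        (trans (sym (proj₂ (∈flowsAt⁻ b f∈b) v)) (proj₂ (∈flowsAt⁻ b′ f∈b′) v)))

  flows-count : length flows ≡ V.sum (tabulate (λ i → length (flowsAt (L.lookup boundaries i))))
  flows-count = length-concatMap flowsAt boundaries

  counting : Σ ℕ λ φ → IsCount (IsNZFlow G k) φ
               × Σ (Vec ℕ (length boundaries)) λ cs →
                   (∀ i → IsCount (InDilate G k (L.lookup boundaries i)) (lookup cs i)) × φ ≡ V.sum cs
  counting =
    length flows , (flows , flows-unique , refl , nzFlow⇔∈flows) ,
    tabulate (λ i → length (flowsAt (L.lookup boundaries i))) ,
    (λ i → subst (IsCount (InDilate G k (L.lookup boundaries i))) (sym (VP.lookup∘tabulate _ i))
                 (dilate-count (L.lookup boundaries i))) ,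
    flows-count

proposition2p3 : ∀ (n m : ℕ) (G : Graph n m) →
    Σ (List (Vec ℤ n)) λ Bs →
    Unique Bs
    × (∀ b → (b ∈ Bs) ⇔ InB G b)
    × (∀ (k : ℕ) → 1 ≤ k →
    Σ ℕ λ φ → IsCount (IsNZFlow G k) φ
    × Σ (Vec ℕ (length Bs)) λ cs →
    (∀ (i : Fin (length Bs)) →
    IsCount (InDilate G k (Data.List.lookup Bs i)) (lookup cs i))
    × φ ≡ Data.Vec.sum cs)
proposition2p3 n m G =
  boundaries , boundaries-unique , ∈boundaries⇔InB , λ k 1≤k → FlowCount.counting G k 1≤k
  where open BoundarySet G
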